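{- Let $\sigma$ be a separable permutation with $\mathrm{sh}(\sigma)=\lambda=(\lambda_1,\lambda_2,\dots)$. For any $d\ge 1$ there exist $d$ pairwise disjoint increasing subsequences $u^1,\dots,u^d$ of $\sigma$ such that $|u^i|=\lambda_i$ for each $i$.
   Context: A permutation is separable if it contains neither of the patterns $3142$ and $2413$ (a permutation $\tau$ contains $\pi\in S_m$ if some length-$m$ subsequence of $\tau$ is in the same relative order as $\pi$). Subsequences are identified with sets of positions; $|u|$ is the length of $u$. The shape $\mathrm{sh}(\sigma)$ is the shape of the insertion tableau of $\sigma$ under the Robinson–Schensted(–Knuth) correspondence via row insertion; partitions have weakly decreasing parts, padded with zeros. -}

module Defs where

open import Data.Nat using (ℕ; zero; suc; _<ᵇ_)
open import Data.Bool using (if_then_else_)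
open import Data.Fin using (Fin; toℕ; _<_) renaming (zero to fz; suc to fs)
open import Data.List using (List; []; _∷_; map; foldl; length; allFin)
open import Data.Maybe using (Maybe; just; nothing)
open import Data.Product using (_×_; _,_; Σ; ∃)
open import Data.Sum using (_⊎_)
open import Data.Empty using (⊥)
open import Function using (_⇔_)
open import Function.Definitions using (Injective)
open import Relation.Binary.PropositionalEquality using (_≡_)
open import Relation.Nullary using (¬_)

-- A permutation of length n: an injective (hence bijective) map on positions
-- 0..n-1, σ(p) being the value at position p.
IsPerm : ∀ {n} → (Fin n → Fin n) → Set
IsPerm σ = Injective _≡_ _≡_ σ

Contains : ∀ {n m} → (Fin n → Fin n) → (Fin m → Fin m) → Set
Contains {n} {m} τ π =
  Σ (Fin m → Fin n) λ f →
    (∀ a b → a < b → f a < f b) ×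
    (∀ a b → (π a < π b) ⇔ (τ (f a) < τ (f b)))

-- patterns written 0-based: 3142 ↦ 2,0,3,1 ; 2413 ↦ 1,3,0,2
p3142 : Fin 4 → Fin 4
p3142 fz = fs (fs fz)
p3142 (fs fz) = fz
p3142 (fs (fs fz)) = fs (fs (fs fz))
p3142 (fs (fs (fs fz))) = fs fz

p2413 : Fin 4 → Fin 4
p2413 fz = fs fz
p2413 (fs fz) = fs (fs (fs fz))
p2413 (fs (fs fz)) = fz
p2413 (fs (fs (fs fz))) = fs (fs fz)

Separable : ∀ {n} → (Fin n → Fin n) → Set
Separable σ = ¬ Contains σ p3142 × ¬ Contains σ p2413

insertRow : ℕ → List ℕ → Maybe ℕ × List ℕ
insertRow x [] = nothing , x ∷ []
insertRow x (y ∷ ys) with x <ᵇ y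
... | Data.Bool.true = just y , x ∷ ys
... | Data.Bool.false with insertRow x ys
...   | b , r = b , y ∷ r

-- Insert x into a tableau (list of rows, top row first).
insertT : ℕ → List (List ℕ) → List (List ℕ)
insertT x [] = (x ∷ []) ∷ []
insertT x (r ∷ rs) with insertRow x r
... | nothing , r' = r' ∷ rs
... | just y , r' = r' ∷ insertT y rs

oneLine : ∀ {n} → (Fin n → Fin n) → List ℕ
oneLine {n} σ = map (λ p → toℕ (σ p)) (allFin n)

insertionTableau : ∀ {n} → (Fin n → Fin n) → List (List ℕ)
insertionTableau σ = foldl (λ T x → insertT x T) [] (oneLine σ)

shape : ∀ {n} → (Fin n → Fin n) → List ℕ
shape σ = map length (insertionTableau σ)

-- i-th part (0-based index) of a partition, padded with zeros
part : List ℕ → ℕ → ℕ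
part [] _ = 0
part (x ∷ xs) zero = x
part (x ∷ xs) (suc i) = part xs i

module Submission where

-- A word is a direct sum u ⊕ v (every letter of u below every letter of v)
-- or a skew sum u ⊖ v (every letter of u above every letter of v).  For the
-- insertion tableau P of row insertion:
--   * P (u ⊕ v) glues the rows of P v behind those of P u, so the shape is
--     the row-wise sum of the two shapes (P-directSum);
--   * P (u ⊖ v) stacks P v column by column on top of P u, so the shape is
--     the decreasing merge of the two shapes (P-skewSum, sh-stack); this is
--     proved by showing that inserting a small letter commutes with stacking.
-- A separable word of length ≥ 2 is a direct or skew sum of two nonempty
-- separable words (SeparableWords.split).  By induction, each increasing
-- separable word ps carries disjoint increasing subsequences whose lengths
-- are the parts of its shape: glue them pairwise for ⊕, merge them by length
-- for ⊖ (Families.family).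

module SeparableRSK where

  open import Defs
  open import Data.Nat using (ℕ; zero; suc; _+_; _∸_; _<ᵇ_; _≤ᵇ_; _≤_; _<_; z≤n; s≤s)
  open import Data.Nat.Properties
  open import Data.Bool using (Bool; true; false; T; if_then_else_)
  open import Data.Unit using (tt)
  open import Data.List using (List; []; _∷_; _++_; length; take; drop; foldl; map; allFin)
  open import Data.List.Properties using (++-identityʳ; ++-assoc; length-++; foldl-++; map-++; length-tabulate; take++drop≡id; take-all; drop-all; drop-[]; length-drop)
  open import Data.List.Relation.Unary.All as All using (All; []; _∷_)
  import Data.List.Relation.Unary.All.Properties as Allₚ
  open import Data.List.Relation.Unary.AllPairs as AllPairs using (AllPairs; []; _∷_)
  import Data.List.Relation.Unary.AllPairs.Properties as AllPairsₚ
  open import Data.List.Relation.Unary.Linked using (Linked; []; [-]; _∷_)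
  open import Data.List.Relation.Binary.Pointwise as Pointwise using (Pointwise; []; _∷_)
  open import Data.Maybe using (just; nothing)
  open import Data.Product using (_×_; _,_; proj₁; proj₂; Σ)
  open import Data.Sum using (_⊎_; inj₁; inj₂)
  open import Data.Empty using (⊥; ⊥-elim)
  open import Relation.Nullary using (¬_; yes; no)
  open import Relation.Binary.PropositionalEquality
  open import Function using (_∘_)
  open import Function.Bundles using (mk⇔)
  open import Data.Fin using (Fin; toℕ; inject₁) renaming (_<_ to _<F_; zero to fzero; suc to fsuc)
  open import Data.Fin.Subset using (Subset; ∣_∣) renaming (_∈_ to _∈ₛ_)
  open import Data.Vec using ([]; _∷_; here; there)
  open import Data.Fin.Properties using (toℕ-injective)
  open import Data.List.Relation.Binary.Sublist.Propositional using (_⊆_; []; _∷_; _∷ʳ_; ⊆-refl; ⊆-trans; minimum; lookup; from∈)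
  open import Data.List.Relation.Binary.Sublist.Propositional.Properties using (All-resp-⊆; ++⁺; ++⁺ˡ; ++⁺ʳ)
  open import Relation.Binary using (tri<; tri≈; tri>)
  open import Data.List.Relation.Unary.Any using (here; there)
  open import Data.List.Membership.Propositional using (_∈_; find)
  open import Data.List.Membership.Propositional.Properties using (∈-++⁻; ∈-++⁺ʳ)
  open import Data.List.Relation.Unary.All.Properties.Core using (¬All⇒Any¬)
  open import Data.List.Extrema.Nat using (min; v<min⁺; min≤⊤; min≤xs)

  <ᵇ⇒<′ : ∀ {x y} → (x <ᵇ y) ≡ true → x < y
  <ᵇ⇒<′ {x} {y} eq = <ᵇ⇒< x y (subst T (sym eq) tt)

  ≮ᵇ⇒≥ : ∀ {x y} → (x <ᵇ y) ≡ false → y ≤ x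
  ≮ᵇ⇒≥ eq = ≮⇒≥ (λ lt → subst T eq (<⇒<ᵇ lt))

  <⇒<ᵇ≡true : ∀ {x y} → x < y → (x <ᵇ y) ≡ true
  <⇒<ᵇ≡true {x} {y} lt with x <ᵇ y | <⇒<ᵇ lt
  ... | true | _ = refl

  ≥⇒<ᵇ≡false : ∀ {x y} → y ≤ x → (x <ᵇ y) ≡ false
  ≥⇒<ᵇ≡false {x} {y} le with x <ᵇ y in eq
  ... | true  = ⊥-elim (<⇒≱ (<ᵇ⇒<′ eq) le)
  ... | false = refl

  Sorted : List ℕ → Set
  Sorted = AllPairs _≤_

  data Above : List ℕ → List ℕ → Set where
    []  : ∀ {r} → Above r []
    _∷_ : ∀ {a b r s} → a < b → Above r s → Above (a ∷ r) (b ∷ s)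

  data NonEmpty {A : Set} : List A → Set where
    nonEmpty : ∀ {x xs} → NonEmpty (x ∷ xs)

  IsTableau : List (List ℕ) → Set
  IsTableau T = All Sorted T × All NonEmpty T × Linked Above T

  insertRow-All : ∀ (Q : ℕ → Set) x r → Q x → All Q r →
    All Q (proj₂ (insertRow x r)) × (∀ {y} → proj₁ (insertRow x r) ≡ just y → Q y)
  insertRow-All Q x [] px [] = px ∷ [] , λ ()
  insertRow-All Q x (a ∷ r) px (pa ∷ pr) with x <ᵇ a
  ... | true  = px ∷ pr , λ { refl → pa }
  ... | false with insertRow x r | insertRow-All Q x r px pr
  ...   | _ , _ | pr′ , pb = pa ∷ pr′ , pb

  insertRow-bumps-larger : ∀ x r {y} → proj₁ (insertRow x r) ≡ just y → x < y
  insertRow-bumps-larger x [] ()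
  insertRow-bumps-larger x (a ∷ r) eq with x <ᵇ a in x<a
  insertRow-bumps-larger x (a ∷ r) refl | true = <ᵇ⇒<′ x<a
  ... | false with insertRow x r in e
  ...   | _ , _ = insertRow-bumps-larger x r (trans (cong proj₁ e) eq)

  -- A bump replaces an entry, so the row keeps its length.
  insertRow-bump-length : ∀ x r {y} → proj₁ (insertRow x r) ≡ just y →
    length (proj₂ (insertRow x r)) ≡ length r
  insertRow-bump-length x [] ()
  insertRow-bump-length x (a ∷ r) eq with x <ᵇ a
  ... | true  = refl
  ... | false with insertRow x r in e
  ...   | _ , _ = cong suc (trans (cong (length ∘ proj₂) (sym e))
                                  (insertRow-bump-length x r (trans (cong proj₁ e) eq)))

  insertRow-append : ∀ x r → proj₁ (insertRow x r) ≡ nothing →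
    proj₂ (insertRow x r) ≡ r ++ x ∷ [] × All (_≤ x) r
  insertRow-append x [] eq = refl , []
  insertRow-append x (a ∷ r) eq with x <ᵇ a in x<a
  insertRow-append x (a ∷ r) () | true
  ... | false with insertRow x r in e
  ...   | _ , _ with insertRow-append x r (trans (cong proj₁ e) eq)
  ...     | r′≡ , r≤x = cong (a ∷_) (trans (cong proj₂ (sym e)) r′≡) , ≮ᵇ⇒≥ x<a ∷ r≤x

  insertRow-skip : ∀ x a c → All (_≤ x) a →
    insertRow x (a ++ c) ≡ (proj₁ (insertRow x c) , a ++ proj₂ (insertRow x c))
  insertRow-skip x [] c [] = refl
  insertRow-skip x (a ∷ as) c (a≤x ∷ as≤x)
    rewrite ≥⇒<ᵇ≡false {x} {a} a≤x | insertRow-skip x as c as≤x = refl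

  insertRow-at-end : ∀ x a → All (_≤ x) a → insertRow x a ≡ (nothing , a ++ x ∷ [])
  insertRow-at-end x a a≤x =
    trans (cong (insertRow x) (sym (++-identityʳ a))) (insertRow-skip x a [] a≤x)

  insertRow-bumps-at : ∀ x a z c → All (_≤ x) a → x < z →
    insertRow x (a ++ z ∷ c) ≡ (just z , a ++ x ∷ c)
  insertRow-bumps-at x a z c a≤x x<z rewrite insertRow-skip x a (z ∷ c) a≤x | <⇒<ᵇ≡true x<z = refl

  insertRow-bump-prefix : ∀ x a c {y} → proj₁ (insertRow x a) ≡ just y →
    insertRow x (a ++ c) ≡ (just y , proj₂ (insertRow x a) ++ c)
  insertRow-bump-prefix x [] c ()
  insertRow-bump-prefix x (a ∷ as) c eq with x <ᵇ a
  insertRow-bump-prefix x (a ∷ as) c refl | true = refl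
  ... | false with insertRow x as | insertRow-bump-prefix x as c
  ...   | just _ , _ | ih rewrite ih eq with eq
  ...     | refl = refl
  insertRow-bump-prefix x (a ∷ as) c () | false | nothing , _ | _

  insertRow-sorted : ∀ x r → Sorted r → Sorted (proj₂ (insertRow x r))
  insertRow-sorted x [] [] = [] ∷ []
  insertRow-sorted x (a ∷ r) (a≤r ∷ r-sorted) with x <ᵇ a in x<a
  ... | true  = All.map (≤-trans (<⇒≤ (<ᵇ⇒<′ x<a))) a≤r ∷ r-sorted
  ... | false = proj₁ (insertRow-All (a ≤_) x r (≮ᵇ⇒≥ x<a) a≤r) ∷ insertRow-sorted x r r-sorted

  insertRow-nonEmpty : ∀ x r → NonEmpty (proj₂ (insertRow x r))
  insertRow-nonEmpty x [] = nonEmpty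
  insertRow-nonEmpty x (a ∷ r) with x <ᵇ a
  ... | true  = nonEmpty
  ... | false with insertRow x r
  ...   | _ , _ = nonEmpty

  insertRow-bump-decreases : ∀ x r {y} → proj₁ (insertRow x r) ≡ just y →
    Pointwise _≤_ (proj₂ (insertRow x r)) r
  insertRow-bump-decreases x [] ()
  insertRow-bump-decreases x (a ∷ r) eq with x <ᵇ a in x<a
  ... | true  = <⇒≤ (<ᵇ⇒<′ x<a) ∷ Pointwise.refl ≤-refl
  ... | false = ≤-refl ∷ insertRow-bump-decreases x r eq

  Above-decrease : ∀ {r r′ s} → Pointwise _≤_ r′ r → Above r s → Above r′ s
  Above-decrease _ [] = []
  Above-decrease (a′≤a ∷ r′≤r) (a<b ∷ r-s) = ≤-<-trans a′≤a a<b ∷ Above-decrease r′≤r r-s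

  Above-snoc : ∀ {r s} x → Above r s → Above (r ++ x ∷ []) s
  Above-snoc x [] = []
  Above-snoc x (a<b ∷ r-s) = a<b ∷ Above-snoc x r-s

  insertRow-bump-Above : ∀ x r s {y} → Above r s → proj₁ (insertRow x r) ≡ just y →
    Above (proj₂ (insertRow x r)) (proj₂ (insertRow y s))
  insertRow-bump-Above x [] s r-s ()
  insertRow-bump-Above x (a ∷ r) [] r-s eq with x <ᵇ a in x<a
  insertRow-bump-Above x (a ∷ r) [] r-s refl | true = <ᵇ⇒<′ x<a ∷ []
  ... | false = ≤-<-trans (≮ᵇ⇒≥ x<a) (insertRow-bumps-larger x r eq) ∷ []
  insertRow-bump-Above x (a ∷ r) (b ∷ s) {y} (a<b ∷ r-s) eq with x <ᵇ a in x<a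
  insertRow-bump-Above x (a ∷ r) (b ∷ s) (a<b ∷ r-s) refl | true
    rewrite <⇒<ᵇ≡true a<b = <ᵇ⇒<′ x<a ∷ r-s
  ... | false with y <ᵇ b
  ...   | true  = ≤-<-trans (≮ᵇ⇒≥ x<a) (insertRow-bumps-larger x r eq)
                  ∷ Above-decrease (insertRow-bump-decreases x r eq) r-s
  ...   | false = a<b ∷ insertRow-bump-Above x r s r-s eq

  -- The first row of insertT y rs, written without the recursive call.
  firstRowAfterInsert : ℕ → List (List ℕ) → List ℕ
  firstRowAfterInsert y [] = y ∷ []
  firstRowAfterInsert y (s ∷ _) = proj₂ (insertRow y s)

  Linked-cons-insertT : ∀ r′ y rs → Above r′ (firstRowAfterInsert y rs) →
    Linked Above (insertT y rs) → Linked Above (r′ ∷ insertT y rs)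
  Linked-cons-insertT r′ y [] r′-s _ = r′-s ∷ [-]
  Linked-cons-insertT r′ y (s ∷ rs) r′-s linked with insertRow y s
  ... | nothing , _ = r′-s ∷ linked
  ... | just _ , _  = r′-s ∷ linked

  Linked-tail : ∀ {r rs} → Linked Above (r ∷ rs) → Linked Above rs
  Linked-tail [-] = []
  Linked-tail (_ ∷ linked) = linked

  Linked-snoc-head : ∀ r x rs → Linked Above (r ∷ rs) → Linked Above ((r ++ x ∷ []) ∷ rs)
  Linked-snoc-head r x [] _ = [-]
  Linked-snoc-head r x (s ∷ rs) (r-s ∷ linked) = Above-snoc x r-s ∷ linked

  insertT-IsTableau : ∀ x T → IsTableau T → IsTableau (insertT x T)
  insertT-IsTableau x [] _ = ([] ∷ []) ∷ [] , nonEmpty ∷ [] , [-]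
  insertT-IsTableau x (r ∷ rs) (r-sorted ∷ rs-sorted , r-ne ∷ rs-ne , linked)
    with insertRow x r in e | insertRow-sorted x r r-sorted | insertRow-nonEmpty x r
  ... | nothing , r′ | r′-sorted | r′-ne =
    r′-sorted ∷ rs-sorted , r′-ne ∷ rs-ne ,
    subst (λ q → Linked Above (q ∷ rs)) (sym r′≡) (Linked-snoc-head r x rs linked)
    where
    r′≡ : r′ ≡ r ++ x ∷ []
    r′≡ = trans (cong proj₂ (sym e)) (proj₁ (insertRow-append x r (cong proj₁ e)))
  ... | just y , r′ | r′-sorted | r′-ne
    with insertT-IsTableau y rs (rs-sorted , rs-ne , Linked-tail linked)
  ...   | sorted′ , ne′ , linked′ =
    r′-sorted ∷ sorted′ , r′-ne ∷ ne′ ,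
    Linked-cons-insertT r′ y rs (subst (λ q → Above (proj₂ q) _) e (firstRow-Above rs linked)) linked′
    where
    firstRow-Above : ∀ rs → Linked Above (r ∷ rs) →
      Above (proj₂ (insertRow x r)) (firstRowAfterInsert y rs)
    firstRow-Above [] _ = insertRow-bump-Above x r [] [] (cong proj₁ e)
    firstRow-Above (s ∷ _) (r-s ∷ _) = insertRow-bump-Above x r s r-s (cong proj₁ e)

  insertAll : List (List ℕ) → List ℕ → List (List ℕ)
  insertAll = foldl (λ T x → insertT x T)

  P : List ℕ → List (List ℕ)
  P = insertAll []

  insertT-All : ∀ (Q : ℕ → Set) x T → Q x → All (All Q) T → All (All Q) (insertT x T)
  insertT-All Q x [] qx _ = (qx ∷ []) ∷ []
  insertT-All Q x (r ∷ rs) qx (qr ∷ qrs) with insertRow x r | insertRow-All Q x r qx qr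
  ... | nothing , _ | qr′ , _  = qr′ ∷ qrs
  ... | just y , _  | qr′ , qy = qr′ ∷ insertT-All Q y rs (qy refl) qrs

  insertAll-All : ∀ (Q : ℕ → Set) T ys → All Q ys → All (All Q) T → All (All Q) (insertAll T ys)
  insertAll-All Q T [] [] qT = qT
  insertAll-All Q T (y ∷ ys) (qy ∷ qys) qT = insertAll-All Q (insertT y T) ys qys (insertT-All Q y T qy qT)

  insertAll-IsTableau : ∀ T ys → IsTableau T → IsTableau (insertAll T ys)
  insertAll-IsTableau T [] t = t
  insertAll-IsTableau T (y ∷ ys) t = insertAll-IsTableau (insertT y T) ys (insertT-IsTableau y T t)

  P-IsTableau : ∀ ys → IsTableau (P ys)
  P-IsTableau ys = insertAll-IsTableau [] ys ([] , [] , [])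

  sh : ∀ {A : Set} → List (List A) → List ℕ
  sh = map length

  -- Direct sums.  If every letter of xs is below every letter of ys then
  -- P (xs ++ ys) is obtained by gluing the rows of P ys behind those of P xs,
  -- so shapes add row by row.
  zipCat : ∀ {A : Set} → List (List A) → List (List A) → List (List A)
  zipCat [] bs = bs
  zipCat (a ∷ as) [] = a ∷ as
  zipCat (a ∷ as) (b ∷ bs) = (a ++ b) ∷ zipCat as bs

  zipCat-[] : ∀ {A : Set} (as : List (List A)) → zipCat as [] ≡ as
  zipCat-[] [] = refl
  zipCat-[] (a ∷ as) = refl

  addShapes : List ℕ → List ℕ → List ℕ
  addShapes [] bs = bs
  addShapes (a ∷ as) [] = a ∷ as
  addShapes (a ∷ as) (b ∷ bs) = (a + b) ∷ addShapes as bs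

  sh-zipCat : ∀ {A : Set} (T S : List (List A)) → sh (zipCat T S) ≡ addShapes (sh T) (sh S)
  sh-zipCat [] S = refl
  sh-zipCat (a ∷ as) [] = refl
  sh-zipCat (a ∷ as) (b ∷ bs) = cong₂ _∷_ (length-++ a) (sh-zipCat as bs)

  insertT-zipCat : ∀ θ y T S → All (All (_< θ)) T → All (All (θ ≤_)) S → θ ≤ y →
    insertT y (zipCat T S) ≡ zipCat T (insertT y S)
  insertT-zipCat θ y [] S _ _ _ = refl
  insertT-zipCat θ y (a ∷ as) [] (a<θ ∷ _) _ θ≤y
    rewrite insertRow-at-end y a (All.map (λ l → <⇒≤ (<-≤-trans l θ≤y)) a<θ) | zipCat-[] as = refl
  insertT-zipCat θ y (a ∷ as) (b ∷ bs) (a<θ ∷ as<θ) (θ≤b ∷ θ≤bs) θ≤y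
    rewrite insertRow-skip y a b (All.map (λ l → <⇒≤ (<-≤-trans l θ≤y)) a<θ)
    with insertRow y b | insertRow-All (θ ≤_) y b θ≤y θ≤b
  ... | nothing , _ | _ = refl
  ... | just z , b′ | _ , θ≤z = cong ((a ++ b′) ∷_) (insertT-zipCat θ z as bs as<θ θ≤bs (θ≤z refl))

  insertAll-zipCat : ∀ θ ys T S → All (All (_< θ)) T → All (All (θ ≤_)) S → All (θ ≤_) ys →
    insertAll (zipCat T S) ys ≡ zipCat T (insertAll S ys)
  insertAll-zipCat θ [] T S _ _ _ = refl
  insertAll-zipCat θ (y ∷ ys) T S T<θ θ≤S (θ≤y ∷ θ≤ys)
    rewrite insertT-zipCat θ y T S T<θ θ≤S θ≤y =
    insertAll-zipCat θ ys T (insertT y S) T<θ (insertT-All (θ ≤_) y S θ≤y θ≤S) θ≤ys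

  P-directSum : ∀ θ xs ys → All (_< θ) xs → All (θ ≤_) ys → P (xs ++ ys) ≡ zipCat (P xs) (P ys)
  P-directSum θ xs ys xs<θ θ≤ys = begin
    P (xs ++ ys)                           ≡⟨ foldl-++ _ [] xs ys ⟩
    insertAll (P xs) ys                    ≡⟨ cong (λ T → insertAll T ys) (sym (zipCat-[] (P xs))) ⟩
    insertAll (zipCat (P xs) []) ys        ≡⟨ insertAll-zipCat θ ys (P xs) [] (insertAll-All (_< θ) [] xs xs<θ []) [] θ≤ys ⟩
    zipCat (P xs) (P ys)                   ∎
    where open ≡-Reasoning

  -- Slicing lists at a column index.  Throughout, "drop m l ≡ z ∷ rest"
  -- says that l has an entry z in column m.
  module _ {A : Set} where

    drop≡∷⇒length-take : ∀ m (l : List A) {z rest} → drop m l ≡ z ∷ rest → length (take m l) ≡ m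
    drop≡∷⇒length-take zero l _ = refl
    drop≡∷⇒length-take (suc m) [] ()
    drop≡∷⇒length-take (suc m) (x ∷ l) e = cong suc (drop≡∷⇒length-take m l e)

    drop≡∷⇒take-suc : ∀ m (l : List A) {z rest} → drop m l ≡ z ∷ rest → take (suc m) l ≡ take m l ++ z ∷ []
    drop≡∷⇒take-suc zero (x ∷ l) refl = refl
    drop≡∷⇒take-suc (suc m) [] ()
    drop≡∷⇒take-suc (suc m) (x ∷ l) e = cong (x ∷_) (drop≡∷⇒take-suc m l e)

    drop≡∷⇒drop-suc : ∀ m (l : List A) {z rest} → drop m l ≡ z ∷ rest → drop (suc m) l ≡ rest
    drop≡∷⇒drop-suc zero (x ∷ l) refl = refl
    drop≡∷⇒drop-suc (suc m) [] ()
    drop≡∷⇒drop-suc (suc m) (x ∷ l) e = drop≡∷⇒drop-suc m l e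

    drop≡[]⇒length≤ : ∀ m (l : List A) → drop m l ≡ [] → length l ≤ m
    drop≡[]⇒length≤ zero [] _ = z≤n
    drop≡[]⇒length≤ (suc m) [] _ = z≤n
    drop≡[]⇒length≤ (suc m) (x ∷ l) e = s≤s (drop≡[]⇒length≤ m l e)

    length-take-≤ : ∀ ℓ (l : List A) → ℓ ≤ length l → length (take ℓ l) ≡ ℓ
    length-take-≤ ℓ l ℓ≤ = trans (Data.List.Properties.length-take ℓ l) (m≤n⇒m⊓n≡m ℓ≤)

    take-take-≤ : ∀ ℓ m (l : List A) → ℓ ≤ m → take ℓ (take m l) ≡ take ℓ l
    take-take-≤ ℓ m l ℓ≤m = trans (Data.List.Properties.take-take ℓ m l) (cong (λ k → take k l) (m≤n⇒m⊓n≡m ℓ≤m))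

    take-++-≤ : ∀ ℓ (a b : List A) → ℓ ≤ length a → take ℓ (a ++ b) ≡ take ℓ a
    take-++-≤ zero a b _ = refl
    take-++-≤ (suc ℓ) (x ∷ a) b (s≤s ℓ≤) = cong (x ∷_) (take-++-≤ ℓ a b ℓ≤)

    drop-++-≤ : ∀ ℓ (a b : List A) → ℓ ≤ length a → drop ℓ (a ++ b) ≡ drop ℓ a ++ b
    drop-++-≤ zero a b _ = refl
    drop-++-≤ (suc ℓ) (x ∷ a) b (s≤s ℓ≤) = drop-++-≤ ℓ a b ℓ≤

    take-++-≥ : ∀ ℓ m (a b : List A) → length a ≡ ℓ → ℓ ≤ m → take m (a ++ b) ≡ a ++ take (m ∸ ℓ) b
    take-++-≥ _ m [] b refl _ = refl
    take-++-≥ _ (suc m) (x ∷ a) b refl (s≤s ℓ≤m) = cong (x ∷_) (take-++-≥ _ m a b refl ℓ≤m)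

    drop-++-≥ : ∀ ℓ m (a b : List A) → length a ≡ ℓ → ℓ ≤ m → drop m (a ++ b) ≡ drop (m ∸ ℓ) b
    drop-++-≥ _ m [] b refl _ = refl
    drop-++-≥ _ (suc m) (x ∷ a) b refl (s≤s ℓ≤m) = drop-++-≥ _ m a b refl ℓ≤m

    take-++-exact : ∀ m (a b : List A) → length a ≡ m → take m (a ++ b) ≡ a
    take-++-exact _ [] b refl = refl
    take-++-exact _ (x ∷ a) b refl = cong (x ∷_) (take-++-exact _ a b refl)

    drop-++-exact : ∀ m (a b : List A) → length a ≡ m → drop m (a ++ b) ≡ b
    drop-++-exact _ [] b refl = refl
    drop-++-exact _ (x ∷ a) b refl = drop-++-exact _ a b refl

    take-∸-drop : ∀ ℓ m (l : List A) → ℓ ≤ m → take (m ∸ ℓ) (drop ℓ l) ≡ drop ℓ (take m l)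
    take-∸-drop ℓ m l ℓ≤m = trans (Data.List.Properties.take-drop (m ∸ ℓ) ℓ l)
                                  (cong (λ k → drop ℓ (take k l)) (m+[n∸m]≡n ℓ≤m))

    drop-∸-drop : ∀ ℓ m (l : List A) → ℓ ≤ m → drop (m ∸ ℓ) (drop ℓ l) ≡ drop m l
    drop-∸-drop ℓ m l ℓ≤m = trans (Data.List.Properties.drop-drop ℓ (m ∸ ℓ) l)
                                  (cong (λ k → drop k l) (m+[n∸m]≡n ℓ≤m))

    drop-split-at-column : ∀ ℓ m (l : List A) {z rest} → ℓ ≤ m → drop m l ≡ z ∷ rest →
      drop ℓ l ≡ drop ℓ (take m l) ++ z ∷ rest
    drop-split-at-column ℓ m l {z} {rest} ℓ≤m e = begin
      drop ℓ l                               ≡⟨ cong (drop ℓ) (sym (take++drop≡id m l)) ⟩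
      drop ℓ (take m l ++ drop m l)          ≡⟨ drop-++-≤ ℓ (take m l) (drop m l) ℓ≤take ⟩
      drop ℓ (take m l) ++ drop m l          ≡⟨ cong (drop ℓ (take m l) ++_) e ⟩
      drop ℓ (take m l) ++ z ∷ rest          ∎
      where
      open ≡-Reasoning
      ℓ≤take : ℓ ≤ length (take m l)
      ℓ≤take = subst (ℓ ≤_) (sym (drop≡∷⇒length-take m l e)) ℓ≤m

    All-at-column : ∀ {Q : A → Set} m (l : List A) {z rest} → All Q l → drop m l ≡ z ∷ rest → Q z
    All-at-column m l ql e with Allₚ.drop⁺ m ql
    ... | q rewrite e with q
    ... | qz ∷ _ = qz

  sorted-left-of-column : ∀ m (l : List ℕ) {z rest} → Sorted l → drop m l ≡ z ∷ rest → All (_≤ z) (take m l)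
  sorted-left-of-column zero l _ _ = []
  sorted-left-of-column (suc m) [] _ ()
  sorted-left-of-column (suc m) (x ∷ l) (x≤l ∷ l-sorted) e =
    All-at-column m l x≤l e ∷ sorted-left-of-column m l l-sorted e

  Above-at-column : ∀ m (a b : List ℕ) {z r z′ r′} → Above a b →
    drop m a ≡ z ∷ r → drop m b ≡ z′ ∷ r′ → z < z′
  Above-at-column zero (x ∷ a) (y ∷ b) (x<y ∷ _) refl refl = x<y
  Above-at-column (suc m) (x ∷ a) (y ∷ b) (_ ∷ a-b) e e′ = Above-at-column m a b a-b e e′

  Above-length : ∀ {a b} → Above a b → length b ≤ length a
  Above-length [] = z≤n
  Above-length (_ ∷ a-b) = s≤s (Above-length a-b)

  Linked-lengths : ∀ r rs → Linked Above (r ∷ rs) → All (λ q → length q ≤ length r) rs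
  Linked-lengths r [] _ = []
  Linked-lengths r (s ∷ rs) (r-s ∷ linked) =
    Above-length r-s ∷ All.map (λ le → ≤-trans le (Above-length r-s)) (Linked-lengths s rs linked)

  -- Column-wise stacking: stack S W is the tableau whose column j
  -- is column j of S followed by column j of W.  Row by row, the first row of
  -- S is completed by the entries of W's first row beyond it; in those columns
  -- the remaining entries of W move one row up (liftFrom), and the process
  -- continues with the next row of S.

  keepNonEmpty : List ℕ → List (List ℕ)
  keepNonEmpty [] = []
  keepNonEmpty (x ∷ xs) = (x ∷ xs) ∷ []

  -- liftFrom m W deletes the top entry of every column j ≥ m of W and moves
  -- the remaining entries of those columns one row up.
  liftFrom : ℕ → List (List ℕ) → List (List ℕ)
  liftFrom m [] = []
  liftFrom m (r ∷ []) = keepNonEmpty (take m r)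
  liftFrom m (r ∷ r′ ∷ rs) = (take m r ++ drop m r′) ∷ liftFrom m (r′ ∷ rs)

  firstRow : List (List ℕ) → List ℕ
  firstRow [] = []
  firstRow (r ∷ _) = r

  stack : List (List ℕ) → List (List ℕ) → List (List ℕ)
  stack [] W = W
  stack (s ∷ ss) W = (s ++ drop (length s) (firstRow W)) ∷ stack ss (liftFrom (length s) W)

  liftFrom-suc-short : ∀ m W → All (λ r → length r ≤ m) W → liftFrom m W ≡ liftFrom (suc m) W
  liftFrom-suc-short m [] _ = refl
  liftFrom-suc-short m (r ∷ []) (r≤ ∷ [])
    rewrite take-all m r r≤ | take-all (suc m) r (≤-trans r≤ (n≤1+n m)) = refl
  liftFrom-suc-short m (r ∷ r′ ∷ rs) (r≤ ∷ r′≤ ∷ rs≤) =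
    cong₂ _∷_ (cong₂ _++_ (trans (take-all m r r≤) (sym (take-all (suc m) r (≤-trans r≤ (n≤1+n m)))))
                          (trans (drop-all m r′ r′≤) (sym (drop-all (suc m) r′ (≤-trans r′≤ (n≤1+n m))))))
              (liftFrom-suc-short m (r′ ∷ rs) (r′≤ ∷ rs≤))

  keepNonEmpty-nonEmpty : ∀ r → NonEmpty r → keepNonEmpty r ≡ r ∷ []
  keepNonEmpty-nonEmpty .(_ ∷ _) nonEmpty = refl

  liftFrom-short : ∀ m W → All (λ r → length r ≤ m) W → All NonEmpty W → liftFrom m W ≡ W
  liftFrom-short m [] _ _ = refl
  liftFrom-short m (r ∷ []) (r≤ ∷ []) (r-ne ∷ []) rewrite take-all m r r≤ = keepNonEmpty-nonEmpty r r-ne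
  liftFrom-short m (r ∷ r′ ∷ rs) (r≤ ∷ r′≤ ∷ rs≤) (_ ∷ ne) =
    cong₂ _∷_ (trans (cong₂ _++_ (take-all m r r≤) (drop-all m r′ r′≤)) (++-identityʳ r))
              (liftFrom-short m (r′ ∷ rs) (r′≤ ∷ rs≤) ne)

  liftFrom-zero : ∀ r rs → liftFrom 0 (r ∷ rs) ≡ rs
  liftFrom-zero r [] = refl
  liftFrom-zero r (r′ ∷ rs) = cong (r′ ∷_) (liftFrom-zero r′ rs)

  liftFrom-head : ∀ ℓ a a′ rs → take ℓ a ≡ take ℓ a′ → liftFrom ℓ (a ∷ rs) ≡ liftFrom ℓ (a′ ∷ rs)
  liftFrom-head ℓ a a′ [] e = cong keepNonEmpty e
  liftFrom-head ℓ a a′ (r′ ∷ rs) e = cong (λ q → (q ++ drop ℓ r′) ∷ liftFrom ℓ (r′ ∷ rs)) e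

  sorted-lift : ∀ ℓ a b → Sorted a → Sorted b → Above a b → Sorted (take ℓ a ++ drop ℓ b)
  sorted-lift zero a b _ b-sorted _ = b-sorted
  sorted-lift (suc ℓ) [] [] _ _ _ = []
  sorted-lift (suc ℓ) (x ∷ a) [] (x≤a ∷ a-sorted) _ _
    rewrite ++-identityʳ (take ℓ a) = Allₚ.take⁺ ℓ x≤a ∷ AllPairsₚ.take⁺ ℓ a-sorted
  sorted-lift (suc ℓ) (x ∷ a) (y ∷ b) (x≤a ∷ a-sorted) (y≤b ∷ b-sorted) (x<y ∷ a-b) =
    Allₚ.++⁺ (Allₚ.take⁺ ℓ x≤a) (Allₚ.drop⁺ ℓ (All.map (≤-trans (<⇒≤ x<y)) y≤b))
    ∷ sorted-lift ℓ a b a-sorted b-sorted a-b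

  Above-lift : ∀ ℓ a b c → Above a b → Above b c → Above (take ℓ a ++ drop ℓ b) (take ℓ b ++ drop ℓ c)
  Above-lift zero a b c _ b-c = b-c
  Above-lift (suc ℓ) a [] [] _ _ = []
  Above-lift (suc ℓ) (x ∷ a) (y ∷ b) [] (x<y ∷ a-b) _ =
    x<y ∷ subst (λ q → Above (take ℓ a ++ drop ℓ b) (take ℓ b ++ q)) (drop-[] ℓ) (Above-lift ℓ a b [] a-b [])
  Above-lift (suc ℓ) (x ∷ a) (y ∷ b) (w ∷ c) (x<y ∷ a-b) (_ ∷ b-c) = x<y ∷ Above-lift ℓ a b c a-b b-c

  Above-lift-last : ∀ ℓ a b → Above a b → Above (take ℓ a ++ drop ℓ b) (take ℓ b)
  Above-lift-last ℓ a b a-b =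
    subst (Above _) (trans (cong (take ℓ b ++_) (drop-[] ℓ)) (++-identityʳ (take ℓ b))) (Above-lift ℓ a b [] a-b [])

  liftFrom-sorted : ∀ ℓ W → All Sorted W → Linked Above W → All Sorted (liftFrom ℓ W)
  liftFrom-sorted ℓ [] _ _ = []
  liftFrom-sorted ℓ (r ∷ []) (r-sorted ∷ []) _ with take ℓ r | AllPairsₚ.take⁺ ℓ r-sorted
  ... | []    | _ = []
  ... | _ ∷ _ | s = s ∷ []
  liftFrom-sorted ℓ (r ∷ r′ ∷ rs) (r-sorted ∷ r′-sorted ∷ rs-sorted) (r-r′ ∷ linked) =
    sorted-lift ℓ r r′ r-sorted r′-sorted r-r′ ∷ liftFrom-sorted ℓ (r′ ∷ rs) (r′-sorted ∷ rs-sorted) linked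

  liftFrom-linked : ∀ ℓ W → Linked Above W → Linked Above (liftFrom ℓ W)
  liftFrom-linked ℓ [] _ = []
  liftFrom-linked ℓ (r ∷ []) _ with take ℓ r
  ... | []    = []
  ... | _ ∷ _ = [-]
  liftFrom-linked ℓ (r ∷ r′ ∷ []) (r-r′ ∷ _) with take ℓ r′ | Above-lift-last ℓ r r′ r-r′
  ... | []    | _ = [-]
  ... | _ ∷ _ | a = a ∷ [-]
  liftFrom-linked ℓ (r ∷ r′ ∷ r″ ∷ rs) (r-r′ ∷ r′-r″ ∷ linked) =
    Above-lift ℓ r r′ r″ r-r′ r′-r″ ∷ liftFrom-linked ℓ (r′ ∷ r″ ∷ rs) (r′-r″ ∷ linked)

  liftFrom-nonEmpty : ∀ ℓ W → 1 ≤ ℓ → All NonEmpty W → All NonEmpty (liftFrom ℓ W)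
  liftFrom-nonEmpty ℓ [] _ _ = []
  liftFrom-nonEmpty ℓ (r ∷ []) _ _ with take ℓ r
  ... | []    = []
  ... | _ ∷ _ = nonEmpty ∷ []
  liftFrom-nonEmpty (suc ℓ) (r ∷ r′ ∷ rs) 1≤ℓ (nonEmpty ∷ ne) = nonEmpty ∷ liftFrom-nonEmpty (suc ℓ) (r′ ∷ rs) 1≤ℓ ne

  liftFrom-IsTableau : ∀ ℓ W → 1 ≤ ℓ → IsTableau W → IsTableau (liftFrom ℓ W)
  liftFrom-IsTableau ℓ W 1≤ℓ (sorted , ne , linked) =
    liftFrom-sorted ℓ W sorted linked , liftFrom-nonEmpty ℓ W 1≤ℓ ne , liftFrom-linked ℓ W linked

  liftFrom-All : ∀ {Q : ℕ → Set} ℓ W → All (All Q) W → All (All Q) (liftFrom ℓ W)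
  liftFrom-All ℓ [] _ = []
  liftFrom-All ℓ (r ∷ []) (qr ∷ []) with take ℓ r | Allₚ.take⁺ ℓ qr
  ... | []    | _ = []
  ... | _ ∷ _ | q = q ∷ []
  liftFrom-All ℓ (r ∷ r′ ∷ rs) (qr ∷ qr′ ∷ qrs) = Allₚ.++⁺ (Allₚ.take⁺ ℓ qr) (Allₚ.drop⁺ ℓ qr′) ∷ liftFrom-All ℓ (r′ ∷ rs) (qr′ ∷ qrs)

  -- ColumnInsertion m z V V⁺: inserting z into V gives V⁺, and every bump
  -- happens in column m (the insertion path is vertical).
  data ColumnInsertion (m : ℕ) : ℕ → List (List ℕ) → List (List ℕ) → Set where
    newRow : ∀ {z} → m ≡ 0 → ColumnInsertion m z [] ((z ∷ []) ∷ [])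
    atEnd  : ∀ {z r rs} → length r ≡ m → All (_≤ z) r →
             ColumnInsertion m z (r ∷ rs) ((r ++ z ∷ []) ∷ rs)
    bump   : ∀ {z r rs z′ rest rs⁺} → drop m r ≡ z′ ∷ rest → All (_≤ z) (take m r) → z < z′ →
             ColumnInsertion m z′ rs rs⁺ → ColumnInsertion m z (r ∷ rs) ((take m r ++ z ∷ rest) ∷ rs⁺)

  insertT-bump : ∀ z r R {z′ r′} → insertRow z r ≡ (just z′ , r′) → insertT z (r ∷ R) ≡ r′ ∷ insertT z′ R
  insertT-bump z r R e with insertRow z r
  insertT-bump z r R refl | .(just _ , _) = refl

  insertT-noBump : ∀ z r R {r′} → insertRow z r ≡ (nothing , r′) → insertT z (r ∷ R) ≡ r′ ∷ R
  insertT-noBump z r R e with insertRow z r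
  insertT-noBump z r R refl | .(nothing , _) = refl

  ColumnInsertion⇒insertT : ∀ {m z V V⁺} → ColumnInsertion m z V V⁺ → insertT z V ≡ V⁺
  ColumnInsertion⇒insertT (newRow _) = refl
  ColumnInsertion⇒insertT (atEnd {z} {r} _ r≤z) rewrite insertRow-at-end z r r≤z = refl
  ColumnInsertion⇒insertT {m} (bump {z} {r} {rs} {z′} {rest} e left≤z z<z′ path) =
    trans (insertT-bump z r rs row) (cong (_ ∷_) (ColumnInsertion⇒insertT path))
    where
    row : insertRow z r ≡ (just z′ , take m r ++ z ∷ rest)
    row = trans (cong (insertRow z) (trans (sym (take++drop≡id m r)) (cong (take m r ++_) e)))
                (insertRow-bumps-at z (take m r) z′ rest left≤z z<z′)

  reinsert-top-of-column : ∀ m W {z rest} → All Sorted W → Linked Above W → drop m (firstRow W) ≡ z ∷ rest →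
    ColumnInsertion m z (liftFrom m W) (liftFrom (suc m) W)
  reinsert-top-of-column zero [] _ _ ()
  reinsert-top-of-column (suc m) [] _ _ ()
  reinsert-top-of-column zero ((w ∷ W₀) ∷ []) _ _ refl = newRow refl
  reinsert-top-of-column (suc m) ([] ∷ []) _ _ ()
  reinsert-top-of-column (suc m) ((w ∷ W₀) ∷ []) {z} (sorted ∷ []) _ e =
    subst (λ q → ColumnInsertion (suc m) z ((w ∷ take m W₀) ∷ []) (q ∷ [])) (sym (drop≡∷⇒take-suc (suc m) (w ∷ W₀) e))
      (atEnd (drop≡∷⇒length-take (suc m) (w ∷ W₀) e) (sorted-left-of-column (suc m) (w ∷ W₀) sorted e))
  reinsert-top-of-column m (W₀ ∷ W₁ ∷ Ws) {z} {rest} (W₀-sorted ∷ sorted) (W₀-W₁ ∷ linked) e with drop m W₁ in e₁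
  ... | [] = subst (ColumnInsertion m z ((take m W₀ ++ []) ∷ liftFrom m (W₁ ∷ Ws))) (sym lifted)
                   (atEnd (trans (cong length (++-identityʳ (take m W₀))) (drop≡∷⇒length-take m W₀ e))
                          (subst (All (_≤ z)) (sym (++-identityʳ (take m W₀))) (sorted-left-of-column m W₀ W₀-sorted e)))
    where
    short : All (λ r → length r ≤ m) (W₁ ∷ Ws)
    short = drop≡[]⇒length≤ m W₁ e₁
          ∷ All.map (λ le → ≤-trans le (drop≡[]⇒length≤ m W₁ e₁)) (Linked-lengths W₁ Ws linked)
    W₁-short : drop (suc m) W₁ ≡ []
    W₁-short = drop-all (suc m) W₁ (≤-trans (drop≡[]⇒length≤ m W₁ e₁) (n≤1+n m))
    lifted : (take (suc m) W₀ ++ drop (suc m) W₁) ∷ liftFrom (suc m) (W₁ ∷ Ws)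
           ≡ ((take m W₀ ++ []) ++ z ∷ []) ∷ liftFrom m (W₁ ∷ Ws)
    lifted = cong₂ _∷_ (trans (cong₂ _++_ (drop≡∷⇒take-suc m W₀ e) W₁-short)
                              (trans (++-identityʳ _) (cong (_++ z ∷ []) (sym (++-identityʳ _)))))
                       (sym (liftFrom-suc-short m (W₁ ∷ Ws) short))
  ... | z₁ ∷ rest₁ =
    subst (λ q → ColumnInsertion m z ((take m W₀ ++ z₁ ∷ rest₁) ∷ liftFrom m (W₁ ∷ Ws)) (q ∷ liftFrom (suc m) (W₁ ∷ Ws)))
          (sym row)
          (bump (drop-++-exact m (take m W₀) (z₁ ∷ rest₁) len)
                (subst (All (_≤ z)) (sym (take-++-exact m (take m W₀) (z₁ ∷ rest₁) len))
                       (sorted-left-of-column m W₀ W₀-sorted e))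
                (Above-at-column m W₀ W₁ W₀-W₁ e e₁)
                (reinsert-top-of-column m (W₁ ∷ Ws) sorted linked e₁))
    where
    len : length (take m W₀) ≡ m
    len = drop≡∷⇒length-take m W₀ e
    row : take (suc m) W₀ ++ drop (suc m) W₁ ≡ take m (take m W₀ ++ z₁ ∷ rest₁) ++ z ∷ rest₁
    row = trans (cong₂ _++_ (drop≡∷⇒take-suc m W₀ e) (drop≡∷⇒drop-suc m W₁ e₁))
                (trans (++-assoc (take m W₀) (z ∷ []) rest₁)
                       (cong (_++ z ∷ rest₁) (sym (take-++-exact m (take m W₀) (z₁ ∷ rest₁) len))))

  module CutBeforeColumn (ℓ m : ℕ) (r : List ℕ) {z′ rest} (ℓ≤m : ℓ ≤ m) (e : drop m r ≡ z′ ∷ rest) where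

    take-cut : ∀ Y → take ℓ (take m r ++ Y) ≡ take ℓ r
    take-cut Y = trans (take-++-≤ ℓ (take m r) Y (subst (ℓ ≤_) (sym (drop≡∷⇒length-take m r e)) ℓ≤m))
                       (take-take-≤ ℓ m r ℓ≤m)

    length-cut : length (take ℓ r) ≡ ℓ
    length-cut = trans (cong length (sym (take-take-≤ ℓ m r ℓ≤m)))
                       (length-take-≤ ℓ (take m r) (subst (ℓ ≤_) (sym (drop≡∷⇒length-take m r e)) ℓ≤m))

    cut≤ : Sorted r → All (_≤ z′) (take ℓ r)
    cut≤ sorted = subst (All (_≤ z′)) (take-take-≤ ℓ m r ℓ≤m) (Allₚ.take⁺ ℓ (sorted-left-of-column m r sorted e))

  ColumnInsertion-liftFrom : ∀ ℓ m {z z′ r rs rest rs⁺} → 1 ≤ ℓ → ℓ ≤ m → Sorted r → All Sorted rs →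
    drop m r ≡ z′ ∷ rest → ColumnInsertion m z′ rs rs⁺ →
    ColumnInsertion m z′ (liftFrom ℓ (r ∷ rs)) (liftFrom ℓ ((take m r ++ z ∷ rest) ∷ rs⁺))
  ColumnInsertion-liftFrom ℓ m 1≤ℓ ℓ≤m _ _ _ (newRow refl) = ⊥-elim (<⇒≱ (≤-trans 1≤ℓ ℓ≤m) z≤n)
  ColumnInsertion-liftFrom ℓ m {z} {z′} {r} {rest = rest} _ ℓ≤m sorted _ e (atEnd {r = r₂} {rs = rs₂} len₂ r₂≤z′) =
    subst (ColumnInsertion m z′ ((take ℓ r ++ drop ℓ r₂) ∷ liftFrom ℓ (r₂ ∷ rs₂))) (sym lifted)
          (atEnd length-row (Allₚ.++⁺ (cut≤ sorted) (Allₚ.drop⁺ ℓ r₂≤z′)))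
    where
    open CutBeforeColumn ℓ m r ℓ≤m e
    ℓ≤r₂ : ℓ ≤ length r₂
    ℓ≤r₂ = subst (ℓ ≤_) (sym len₂) ℓ≤m
    length-row : length (take ℓ r ++ drop ℓ r₂) ≡ m
    length-row = trans (length-++ (take ℓ r))
      (trans (cong₂ _+_ length-cut (trans (length-drop ℓ r₂) (cong (_∸ ℓ) len₂))) (m+[n∸m]≡n ℓ≤m))
    lifted : liftFrom ℓ ((take m r ++ z ∷ rest) ∷ (r₂ ++ z′ ∷ []) ∷ rs₂)
           ≡ ((take ℓ r ++ drop ℓ r₂) ++ z′ ∷ []) ∷ liftFrom ℓ (r₂ ∷ rs₂)
    lifted = cong₂ _∷_
      (trans (cong₂ _++_ (take-cut (z ∷ rest)) (drop-++-≤ ℓ r₂ (z′ ∷ []) ℓ≤r₂))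
             (sym (++-assoc (take ℓ r) (drop ℓ r₂) (z′ ∷ []))))
      (liftFrom-head ℓ (r₂ ++ z′ ∷ []) r₂ rs₂ (take-++-≤ ℓ r₂ (z′ ∷ []) ℓ≤r₂))
  ColumnInsertion-liftFrom ℓ m {z} {z′} {r} {rest = rest} 1≤ℓ ℓ≤m sorted (sorted₂ ∷ sorted′) e
    (bump {r = r₂} {rs = rs₂} {z′ = z″} {rest = rest₂} {rs⁺ = rs₂⁺} e₂ r₂≤z′ z′<z″ path) =
    subst (ColumnInsertion m z′ (X ∷ liftFrom ℓ (r₂ ∷ rs₂))) (sym lifted)
          (bump drop-X take-X≤ z′<z″ (ColumnInsertion-liftFrom ℓ m {z = z′} 1≤ℓ ℓ≤m sorted₂ sorted′ e₂ path))
    where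
    open CutBeforeColumn ℓ m r ℓ≤m e
    X : List ℕ
    X = take ℓ r ++ drop ℓ r₂
    take-X : take m X ≡ take ℓ r ++ drop ℓ (take m r₂)
    take-X = trans (take-++-≥ ℓ m (take ℓ r) (drop ℓ r₂) length-cut ℓ≤m) (cong (take ℓ r ++_) (take-∸-drop ℓ m r₂ ℓ≤m))
    drop-X : drop m X ≡ z″ ∷ rest₂
    drop-X = trans (drop-++-≥ ℓ m (take ℓ r) (drop ℓ r₂) length-cut ℓ≤m) (trans (drop-∸-drop ℓ m r₂ ℓ≤m) e₂)
    take-X≤ : All (_≤ z′) (take m X)
    take-X≤ = subst (All (_≤ z′)) (sym take-X) (Allₚ.++⁺ (cut≤ sorted) (Allₚ.drop⁺ ℓ r₂≤z′))
    lifted : liftFrom ℓ ((take m r ++ z ∷ rest) ∷ (take m r₂ ++ z′ ∷ rest₂) ∷ rs₂⁺)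
           ≡ (take m X ++ z′ ∷ rest₂) ∷ liftFrom ℓ ((take m r₂ ++ z′ ∷ rest₂) ∷ rs₂⁺)
    lifted = cong (_∷ liftFrom ℓ ((take m r₂ ++ z′ ∷ rest₂) ∷ rs₂⁺))
      (trans (cong₂ _++_ (take-cut (z ∷ rest))
                         (drop-++-≤ ℓ (take m r₂) (z′ ∷ rest₂) (subst (ℓ ≤_) (sym (drop≡∷⇒length-take m r₂ e₂)) ℓ≤m)))
             (trans (sym (++-assoc (take ℓ r) (drop ℓ (take m r₂)) (z′ ∷ rest₂))) (cong (_++ z′ ∷ rest₂) (sym take-X))))

  nonEmpty-length : ∀ {A : Set} {s : List A} → NonEmpty s → 1 ≤ length s
  nonEmpty-length nonEmpty = s≤s z≤n

  insertT-stack-vertical : ∀ ss {m z V V⁺} → ColumnInsertion m z V V⁺ →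
    All (λ s → length s ≤ m) ss → All NonEmpty ss → All (All (_< z)) ss →
    All Sorted V → Linked Above V → insertT z (stack ss V) ≡ stack ss V⁺
  insertT-stack-vertical [] path _ _ _ _ _ = ColumnInsertion⇒insertT path
  insertT-stack-vertical (s ∷ ss) (newRow refl) (s≤ ∷ _) (s-ne ∷ _) _ _ _ = ⊥-elim (<⇒≱ (nonEmpty-length s-ne) s≤)
  insertT-stack-vertical (s ∷ ss) {m} {z} (atEnd {r = r} {rs = rs} len r≤z) (s≤ ∷ _) _ (s<z ∷ _) _ _ =
    trans (insertT-noBump z (s ++ drop (length s) r) _
             (insertRow-at-end z _ (Allₚ.++⁺ (All.map <⇒≤ s<z) (Allₚ.drop⁺ (length s) r≤z))))
          (cong₂ _∷_ (trans (++-assoc s (drop (length s) r) (z ∷ []))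
                            (cong (s ++_) (sym (drop-++-≤ (length s) r (z ∷ []) s≤r))))
                     (cong (stack ss) (sym (liftFrom-head (length s) (r ++ z ∷ []) r rs (take-++-≤ (length s) r (z ∷ []) s≤r)))))
    where
    s≤r : length s ≤ length r
    s≤r = subst (length s ≤_) (sym len) s≤
  insertT-stack-vertical (s ∷ ss) {m} {z} (bump {r = r} {rs = rs} {z′ = z′} {rest = rest} e r≤z z<z′ path)
    (s≤ ∷ ss≤) (s-ne ∷ ss-ne) (s<z ∷ ss<z) (r-sorted ∷ rs-sorted) linked =
    trans (insertT-bump z (s ++ drop ℓ r) _ row-insertion)
          (cong₂ _∷_ new-row
                 (insertT-stack-vertical ss (ColumnInsertion-liftFrom ℓ m {z = z} (nonEmpty-length s-ne) s≤ r-sorted rs-sorted e path)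
                    ss≤ ss-ne (All.map (All.map (λ q → <-trans q z<z′)) ss<z)
                    (liftFrom-sorted ℓ (r ∷ rs) (r-sorted ∷ rs-sorted) linked) (liftFrom-linked ℓ (r ∷ rs) linked)))
    where
    ℓ : ℕ
    ℓ = length s
    row : s ++ drop ℓ r ≡ (s ++ drop ℓ (take m r)) ++ z′ ∷ rest
    row = trans (cong (s ++_) (drop-split-at-column ℓ m r s≤ e)) (sym (++-assoc s (drop ℓ (take m r)) (z′ ∷ rest)))
    row-insertion : insertRow z (s ++ drop ℓ r) ≡ (just z′ , (s ++ drop ℓ (take m r)) ++ z ∷ rest)
    row-insertion = trans (cong (insertRow z) row)
      (insertRow-bumps-at z (s ++ drop ℓ (take m r)) z′ rest (Allₚ.++⁺ (All.map <⇒≤ s<z) (Allₚ.drop⁺ ℓ r≤z)) z<z′)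
    new-row : (s ++ drop ℓ (take m r)) ++ z ∷ rest ≡ s ++ drop ℓ (take m r ++ z ∷ rest)
    new-row = trans (++-assoc s (drop ℓ (take m r)) (z ∷ rest))
      (cong (s ++_) (sym (drop-++-≤ ℓ (take m r) (z ∷ rest) (subst (ℓ ≤_) (sym (drop≡∷⇒length-take m r e)) s≤))))

  rows-short : ∀ m W → Linked Above W → length (firstRow W) ≤ m → All (λ r → length r ≤ m) W
  rows-short m [] _ _ = []
  rows-short m (r ∷ rs) linked r≤ = r≤ ∷ All.map (λ le → ≤-trans le r≤) (Linked-lengths r rs linked)

  -- A small letter y appended at the end of the top row s of S: in the
  -- stacked tableau it bumps the entry of W's first row in column |s|, which
  -- then travels down that column.
  insertT-stack-append : ∀ θ y s ss W → NonEmpty s → All (λ q → length q ≤ length s) ss → All NonEmpty ss →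
    All (All (_< θ)) ss → IsTableau W → All (All (θ ≤_)) W → y < θ → All (_≤ y) s →
    insertT y ((s ++ drop (length s) (firstRow W)) ∷ stack ss (liftFrom (length s) W)) ≡ stack ((s ++ y ∷ []) ∷ ss) W
  insertT-stack-append θ y s ss W _ ss≤ ss-ne ss<θ (W-sorted , W-ne , W-linked) θ≤W y<θ s≤y
    with drop (length s) (firstRow W) in e
  ... | [] = trans (insertT-noBump y (s ++ []) _ (insertRow-at-end y (s ++ []) (subst (All (_≤ y)) (sym (++-identityʳ s)) s≤y)))
                   (cong₂ _∷_ row (cong (stack ss) lifted))
    where
    m : ℕ
    m = length s
    row : (s ++ []) ++ y ∷ [] ≡ (s ++ y ∷ []) ++ drop (length (s ++ y ∷ [])) (firstRow W)
    row rewrite length-++ s {y ∷ []} | +-comm (length s) 1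
              | drop-all (suc m) (firstRow W) (≤-trans (drop≡[]⇒length≤ m (firstRow W) e) (n≤1+n m))
              | ++-identityʳ s | ++-identityʳ (s ++ y ∷ []) = refl
    lifted : liftFrom m W ≡ liftFrom (length (s ++ y ∷ [])) W
    lifted rewrite length-++ s {y ∷ []} | +-comm (length s) 1 =
      liftFrom-suc-short m W (rows-short m W W-linked (drop≡[]⇒length≤ m (firstRow W) e))
  ... | z ∷ rest = trans (insertT-bump y (s ++ z ∷ rest) _ (insertRow-bumps-at y s z rest s≤y (<-≤-trans y<θ θ≤z)))
                         (cong₂ _∷_ row (trans down lifted))
    where
    m : ℕ
    m = length s
    θ≤z : θ ≤ z
    θ≤z = All-at-column m (firstRow W) (first-All W θ≤W) e
      where
      first-All : ∀ W → All (All (θ ≤_)) W → All (θ ≤_) (firstRow W)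
      first-All [] _ = []
      first-All (_ ∷ _) (q ∷ _) = q
    row : s ++ y ∷ rest ≡ (s ++ y ∷ []) ++ drop (length (s ++ y ∷ [])) (firstRow W)
    row rewrite length-++ s {y ∷ []} | +-comm (length s) 1 | drop≡∷⇒drop-suc m (firstRow W) e =
      sym (++-assoc s (y ∷ []) rest)
    down : insertT z (stack ss (liftFrom m W)) ≡ stack ss (liftFrom (suc m) W)
    down = insertT-stack-vertical ss (reinsert-top-of-column m W W-sorted W-linked e) ss≤ ss-ne
             (All.map (All.map (λ q → <-≤-trans q θ≤z)) ss<θ)
             (liftFrom-sorted m W W-sorted W-linked) (liftFrom-linked m W W-linked)
    lifted : stack ss (liftFrom (suc m) W) ≡ stack ss (liftFrom (length (s ++ y ∷ [])) W)
    lifted rewrite length-++ s {y ∷ []} | +-comm (length s) 1 = refl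

  insertT-stack : ∀ θ y S W → IsTableau S → IsTableau W → All (All (_< θ)) S → All (All (θ ≤_)) W → y < θ →
    insertT y (stack S W) ≡ stack (insertT y S) W
  insertT-stack θ y [] [] _ _ _ _ _ = refl
  insertT-stack θ y [] ([] ∷ Ws) _ (_ , () ∷ _ , _) _ _ _
  insertT-stack θ y [] ((w ∷ W₀) ∷ Ws) _ (W-sorted , _ , W-linked) _ ((θ≤w ∷ _) ∷ _) y<θ =
    trans (insertT-bump y (w ∷ W₀) Ws (insertRow-bumps-at y [] w W₀ [] (<-≤-trans y<θ θ≤w)))
          (cong ((y ∷ W₀) ∷_) (trans (cong (insertT w) (sym (liftFrom-zero (w ∷ W₀) Ws)))
                                     (ColumnInsertion⇒insertT (reinsert-top-of-column 0 ((w ∷ W₀) ∷ Ws) W-sorted W-linked refl))))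
  insertT-stack θ y (s ∷ ss) W (s-sorted ∷ ss-sorted , s-ne ∷ ss-ne , S-linked) tW (s<θ ∷ ss<θ) θ≤W y<θ =
    by-row-insertion (insertRow y s) refl
    where
    m : ℕ
    m = length s
    X : List ℕ
    X = drop m (firstRow W)
    below : ∀ b → b < θ → insertT b (stack ss (liftFrom m W)) ≡ stack (insertT b ss) (liftFrom m W)
    below b b<θ = insertT-stack θ b ss (liftFrom m W) (ss-sorted , ss-ne , Linked-tail S-linked)
                    (liftFrom-IsTableau m W (nonEmpty-length s-ne) tW) ss<θ (liftFrom-All m W θ≤W) b<θ
    by-row-insertion : ∀ p → insertRow y s ≡ p →
      insertT y ((s ++ X) ∷ stack ss (liftFrom m W)) ≡ stack (insertT y (s ∷ ss)) W
    by-row-insertion (just b , s′) e rewrite e =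
      trans (insertT-bump y (s ++ X) _ bumped)
            (cong₂ _∷_ (cong (λ k → s′ ++ drop k (firstRow W)) (sym same-length))
                       (trans (below b b<θ) (cong (λ k → stack (insertT b ss) (liftFrom k W)) (sym same-length))))
      where
      bumped : insertRow y (s ++ X) ≡ (just b , s′ ++ X)
      bumped = trans (insertRow-bump-prefix y s X (cong proj₁ e)) (cong (λ p → (just b , proj₂ p ++ X)) e)
      same-length : length s′ ≡ length s
      same-length = trans (cong (length ∘ proj₂) (sym e)) (insertRow-bump-length y s (cong proj₁ e))
      b<θ : b < θ
      b<θ = proj₂ (insertRow-All (_< θ) y s y<θ s<θ) (cong proj₁ e)
    by-row-insertion (nothing , s′) e rewrite e =
      subst (λ q → insertT y ((s ++ X) ∷ stack ss (liftFrom m W)) ≡ stack (q ∷ ss) W) (sym s′≡)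
            (insertT-stack-append θ y s ss W s-ne (Linked-lengths s ss S-linked) ss-ne ss<θ tW θ≤W y<θ
                                  (proj₂ (insertRow-append y s (cong proj₁ e))))
      where
      s′≡ : s′ ≡ s ++ y ∷ []
      s′≡ = trans (cong proj₂ (sym e)) (proj₁ (insertRow-append y s (cong proj₁ e)))

  insertAll-stack : ∀ θ ys S W → IsTableau S → IsTableau W → All (All (_< θ)) S → All (All (θ ≤_)) W →
    All (_< θ) ys → insertAll (stack S W) ys ≡ stack (insertAll S ys) W
  insertAll-stack θ [] S W _ _ _ _ _ = refl
  insertAll-stack θ (y ∷ ys) S W tS tW S<θ θ≤W (y<θ ∷ ys<θ) rewrite insertT-stack θ y S W tS tW S<θ θ≤W y<θ =
    insertAll-stack θ ys (insertT y S) W (insertT-IsTableau y S tS) tW (insertT-All (_< θ) y S y<θ S<θ) θ≤W ys<θ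

  P-skewSum : ∀ θ xs ys → All (θ ≤_) xs → All (_< θ) ys → P (xs ++ ys) ≡ stack (P ys) (P xs)
  P-skewSum θ xs ys θ≤xs ys<θ = trans (foldl-++ _ [] xs ys)
    (insertAll-stack θ ys [] (P xs) ([] , [] , []) (P-IsTableau xs) [] (insertAll-All (θ ≤_) [] xs θ≤xs []) ys<θ)

  -- Merging two lists that are sorted decreasingly by a key f.  The shape of
  -- a column-wise stack is the merge of the two shapes.
  mergeOn : ∀ {A : Set} → (A → ℕ) → List A → List A → List A
  mergeOn f [] ys = ys
  mergeOn f (x ∷ xs) [] = x ∷ xs
  mergeOn f (x ∷ xs) (y ∷ ys) = if f y ≤ᵇ f x then x ∷ mergeOn f xs (y ∷ ys) else y ∷ mergeOn f (x ∷ xs) ys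

  mergeShapes : List ℕ → List ℕ → List ℕ
  mergeShapes = mergeOn (λ k → k)

  module _ {A : Set} (f : A → ℕ) where

    mergeOn-left : ∀ x xs y ys → f y ≤ f x → mergeOn f (x ∷ xs) (y ∷ ys) ≡ x ∷ mergeOn f xs (y ∷ ys)
    mergeOn-left x xs y ys y≤x with f y ≤ᵇ f x | ≤⇒≤ᵇ y≤x
    ... | true | _ = refl

    mergeOn-right : ∀ x xs y ys → f x < f y → mergeOn f (x ∷ xs) (y ∷ ys) ≡ y ∷ mergeOn f (x ∷ xs) ys
    mergeOn-right x xs y ys x<y with f y ≤ᵇ f x in e
    ... | true  = ⊥-elim (<⇒≱ x<y (≤ᵇ⇒≤ (f y) (f x) (subst T (sym e) tt)))
    ... | false = refl

    mergeOn-[] : ∀ xs → mergeOn f xs [] ≡ xs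
    mergeOn-[] [] = refl
    mergeOn-[] (x ∷ xs) = refl

    map-mergeOn : ∀ xs ys → map f (mergeOn f xs ys) ≡ mergeShapes (map f xs) (map f ys)
    map-mergeOn [] ys = refl
    map-mergeOn (x ∷ xs) ys = against ys
      where
      against : ∀ ys → map f (mergeOn f (x ∷ xs) ys) ≡ mergeShapes (map f (x ∷ xs)) (map f ys)
      against [] = refl
      against (y ∷ ys) with f y ≤ᵇ f x
      ... | true  = cong (f x ∷_) (map-mergeOn xs (y ∷ ys))
      ... | false = cong (f y ∷_) (against ys)

  data HeadAtMost (m : ℕ) : List ℕ → Set where
    emptyList : HeadAtMost m []
    headAtMost : ∀ {w ws} → w ≤ m → HeadAtMost m (w ∷ ws)

  mergeShapes-cons-max : ∀ m xs ws → All (_≤ m) xs → HeadAtMost m ws →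
    mergeShapes xs (m ∷ ws) ≡ m ∷ mergeShapes xs ws
  mergeShapes-cons-max m [] ws _ _ = refl
  mergeShapes-cons-max m (x ∷ xs) ws (x≤m ∷ xs≤m) ws≤m with m ≤? x
  ... | no m≰x = mergeOn-right (λ k → k) x xs m ws (≰⇒> m≰x)
  ... | yes m≤x rewrite ≤-antisym x≤m m≤x | mergeOn-left (λ k → k) m xs m ws ≤-refl
                      | mergeShapes-cons-max m xs ws xs≤m ws≤m = cong (m ∷_) (sym (front ws ws≤m))
    where
    front : ∀ ws → HeadAtMost m ws → mergeShapes (m ∷ xs) ws ≡ m ∷ mergeShapes xs ws
    front [] _ = cong (m ∷_) (sym (mergeOn-[] (λ k → k) xs))
    front (w ∷ ws) (headAtMost w≤m) = mergeOn-left (λ k → k) m xs w ws w≤m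

  mergeShapes-cons-larger : ∀ y xs ws → All (_< y) xs → mergeShapes xs (y ∷ ws) ≡ y ∷ mergeShapes xs ws
  mergeShapes-cons-larger y [] ws _ = refl
  mergeShapes-cons-larger y (x ∷ xs) ws (x<y ∷ _) = mergeOn-right (λ k → k) x xs y ws x<y

  mergeShapes-singleton : ∀ m xs ys → All (_≤ m) xs → mergeShapes xs (mergeShapes (m ∷ []) ys) ≡ mergeShapes (m ∷ xs) ys
  mergeShapes-singleton m xs [] xs≤m = trans (mergeShapes-cons-max m xs [] xs≤m emptyList) (cong (m ∷_) (mergeOn-[] (λ k → k) xs))
  mergeShapes-singleton m xs (y ∷ ys) xs≤m with y ≤? m
  ... | yes y≤m rewrite mergeOn-left (λ k → k) m [] y ys y≤m | mergeOn-left (λ k → k) m xs y ys y≤m =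
    mergeShapes-cons-max m xs (y ∷ ys) xs≤m (headAtMost y≤m)
  ... | no y≰m rewrite mergeOn-right (λ k → k) m [] y ys (≰⇒> y≰m) | mergeOn-right (λ k → k) m xs y ys (≰⇒> y≰m) =
    trans (mergeShapes-cons-larger y xs _ (All.map (λ q → ≤-<-trans q (≰⇒> y≰m)) xs≤m))
          (cong (y ∷_) (mergeShapes-singleton m xs ys xs≤m))

  sh-keepNonEmpty : ∀ r → 1 ≤ length r → sh (keepNonEmpty r) ≡ length r ∷ []
  sh-keepNonEmpty (x ∷ r) _ = refl

  length-lift : ∀ m (a b : List ℕ) → m ≤ length a → length (take m a ++ drop m b) ≡ m + (length b ∸ m)
  length-lift m a b m≤a = trans (length-++ (take m a)) (cong₂ _+_ (length-take-≤ m a m≤a) (length-drop m b))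

  -- Lifting the columns ≥ m of a tableau whose first row is longer than m:
  -- the rows below the first shift up, and a new row of length m appears
  -- (in its sorted position).
  sh-liftFrom : ∀ m W₀ Ws → 1 ≤ m → m < length W₀ → IsTableau (W₀ ∷ Ws) →
    sh (liftFrom m (W₀ ∷ Ws)) ≡ mergeShapes (m ∷ []) (sh Ws)
  sh-liftFrom m W₀ [] 1≤m m<W₀ _ =
    trans (sh-keepNonEmpty (take m W₀) (subst (1 ≤_) (sym (length-take-≤ m W₀ (<⇒≤ m<W₀))) 1≤m))
          (cong (_∷ []) (length-take-≤ m W₀ (<⇒≤ m<W₀)))
  sh-liftFrom m W₀ (W₁ ∷ Ws) 1≤m m<W₀ (_ ∷ sorted , _ ∷ ne , _ ∷ linked) with m <? length W₁
  ... | yes m<W₁ = trans (cong₂ _∷_ (trans (length-lift m W₀ W₁ (<⇒≤ m<W₀)) (m+[n∸m]≡n (<⇒≤ m<W₁)))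
                                    (sh-liftFrom m W₁ Ws 1≤m m<W₁ (sorted , ne , linked)))
                         (sym (mergeOn-right (λ k → k) m [] (length W₁) (sh Ws) m<W₁))
  ... | no m≮W₁ = trans (cong₂ _∷_ (trans (length-lift m W₀ W₁ (<⇒≤ m<W₀))
                                          (trans (cong (m +_) (m≤n⇒m∸n≡0 (≮⇒≥ m≮W₁))) (+-identityʳ m)))
                                   (cong sh (liftFrom-short m (W₁ ∷ Ws) (rows-short m (W₁ ∷ Ws) linked (≮⇒≥ m≮W₁)) ne)))
                        (sym (mergeOn-left (λ k → k) m [] (length W₁) (sh Ws) (≮⇒≥ m≮W₁)))

  sh-stack : ∀ S W → IsTableau S → IsTableau W → sh (stack S W) ≡ mergeShapes (sh S) (sh W)
  sh-stack [] W _ _ = refl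
  sh-stack (s ∷ ss) [] (_ ∷ ss-sorted , _ ∷ ss-ne , S-linked) tW =
    cong₂ _∷_ (trans (cong (λ q → length (s ++ q)) (drop-[] (length s))) (cong length (++-identityʳ s)))
              (trans (sh-stack ss [] (ss-sorted , ss-ne , Linked-tail S-linked) tW) (mergeOn-[] (λ k → k) (sh ss)))
  sh-stack (s ∷ ss) (W₀ ∷ Ws) (_ ∷ ss-sorted , s-ne ∷ ss-ne , S-linked) tW@(_ , W-ne , W-linked)
    with length W₀ ≤? length s
  ... | yes W₀≤s =
    trans (cong₂ _∷_ (trans (length-++ s) (trans (cong (length s +_) (trans (length-drop (length s) W₀) (m≤n⇒m∸n≡0 W₀≤s)))
                                                 (+-identityʳ _)))
                     (trans (cong (λ q → sh (stack ss q)) (liftFrom-short (length s) (W₀ ∷ Ws) (rows-short (length s) (W₀ ∷ Ws) W-linked W₀≤s) W-ne))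
                            (sh-stack ss (W₀ ∷ Ws) tS′ tW)))
          (sym (mergeOn-left (λ k → k) (length s) (sh ss) (length W₀) (sh Ws) W₀≤s))
    where
    tS′ : IsTableau ss
    tS′ = (ss-sorted , ss-ne , Linked-tail S-linked)
  ... | no W₀≰s =
    trans (cong₂ _∷_ (trans (length-++ s) (trans (cong (length s +_) (length-drop (length s) W₀)) (m+[n∸m]≡n (<⇒≤ s<W₀))))
                     (begin
                       sh (stack ss (liftFrom (length s) (W₀ ∷ Ws)))
                         ≡⟨ sh-stack ss (liftFrom (length s) (W₀ ∷ Ws)) tS′ (liftFrom-IsTableau (length s) (W₀ ∷ Ws) (nonEmpty-length s-ne) tW) ⟩
                       mergeShapes (sh ss) (sh (liftFrom (length s) (W₀ ∷ Ws)))
                         ≡⟨ cong (mergeShapes (sh ss)) (sh-liftFrom (length s) W₀ Ws (nonEmpty-length s-ne) s<W₀ tW) ⟩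
                       mergeShapes (sh ss) (mergeShapes (length s ∷ []) (sh Ws))
                         ≡⟨ mergeShapes-singleton (length s) (sh ss) (sh Ws) (Allₚ.map⁺ (Linked-lengths s ss S-linked)) ⟩
                       mergeShapes (length s ∷ sh ss) (sh Ws) ∎))
          (sym (mergeOn-right (λ k → k) (length s) (sh ss) (length W₀) (sh Ws) s<W₀))
    where
    open ≡-Reasoning
    s<W₀ : length s < length W₀
    s<W₀ = ≰⇒> W₀≰s
    tS′ : IsTableau ss
    tS′ = (ss-sorted , ss-ne , Linked-tail S-linked)

  -- Increasing subsequences of a fixed permutation σ are handled as lists of
  -- positions.  A sublist of positions is a subsequence.
  AllPairs-resp-⊆ : ∀ {A : Set} {R : A → A → Set} {xs ys : List A} → xs ⊆ ys → AllPairs R ys → AllPairs R xs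
  AllPairs-resp-⊆ [] r = r
  AllPairs-resp-⊆ (_ ∷ʳ τ) (_ ∷ r) = AllPairs-resp-⊆ τ r
  AllPairs-resp-⊆ (refl ∷ τ) (rx ∷ r) = All-resp-⊆ τ rx ∷ AllPairs-resp-⊆ τ r

  ++-nonEmpty : ∀ {A : Set} (u : List A) {v} → NonEmpty v → NonEmpty (u ++ v)
  ++-nonEmpty [] v-ne = v-ne
  ++-nonEmpty (x ∷ u) _ = nonEmpty

  ++-length-right : ∀ {A : Set} (u v : List A) → NonEmpty u → suc (length v) ≤ length (u ++ v)
  ++-length-right (x ∷ u) v _ = s≤s (subst (length v ≤_) (sym (length-++ u)) (m≤n+m (length v) (length u)))

  ++-length-left : ∀ {A : Set} (u v : List A) → NonEmpty v → suc (length u) ≤ length (u ++ v)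
  ++-length-left [] (y ∷ v) _ = s≤s z≤n
  ++-length-left (x ∷ u) v v-ne = s≤s (++-length-left u v v-ne)

  module SeparableWords {n : ℕ} (σ : Fin n → Fin n) (σ-injective : IsPerm σ) where

    val : Fin n → ℕ
    val p = toℕ (σ p)

    Increasing : List (Fin n) → Set
    Increasing = AllPairs _<F_

    Below : List (Fin n) → List (Fin n) → Set
    Below u v = All (λ p → All (λ q → val p < val q) v) u

    Pattern3142 Pattern2413 : Fin n → Fin n → Fin n → Fin n → Set
    Pattern3142 a b c d = val b < val d × val d < val a × val a < val c
    Pattern2413 a b c d = val c < val a × val a < val d × val d < val b

    Avoids : List (Fin n) → Set
    Avoids ps = ∀ a b c d → (a ∷ b ∷ c ∷ d ∷ []) ⊆ ps → ¬ Pattern3142 a b c d × ¬ Pattern2413 a b c d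

    Avoids-⊆ : ∀ {xs ys} → xs ⊆ ys → Avoids ys → Avoids xs
    Avoids-⊆ τ avoids a b c d τ′ = avoids a b c d (⊆-trans τ′ τ)

    val-trichotomy : ∀ {p q} → p <F q → val p < val q ⊎ val q < val p
    val-trichotomy {p} {q} p<q with <-cmp (val p) (val q)
    ... | tri< lt _ _ = inj₁ lt
    ... | tri≈ _ eq _ = ⊥-elim (<-irrefl (cong toℕ (σ-injective (toℕ-injective eq))) p<q)
    ... | tri> _ _ gt = inj₂ gt

    Split : List (Fin n) → Set
    Split ps = Σ (List (Fin n)) λ u → Σ (List (Fin n)) λ v →
      u ++ v ≡ ps × NonEmpty u × NonEmpty v × (Below u v ⊎ Below v u)

    some-above : ∀ x v → All (x <F_) v → ¬ All (λ q → val q < val x) v → Σ (Fin n) λ c → c ∈ v × val x < val c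
    some-above x v x<v ¬v<x with find (¬All⇒Any¬ (λ q → val q <? val x) v ¬v<x)
    ... | c , c∈v , c≮x with val-trichotomy (All.lookup x<v c∈v)
    ...   | inj₁ x<c = c , c∈v , x<c
    ...   | inj₂ c<x = ⊥-elim (c≮x c<x)

    some-below : ∀ x v → All (x <F_) v → ¬ All (λ q → val x < val q) v → Σ (Fin n) λ c → c ∈ v × val c < val x
    some-below x v x<v ¬x<v with find (¬All⇒Any¬ (λ q → val x <? val q) v ¬x<v)
    ... | c , c∈v , x≮c with val-trichotomy (All.lookup x<v c∈v)
    ...   | inj₁ x<c = ⊥-elim (x≮c x<c)
    ...   | inj₂ c<x = c , c∈v , c<x

    four-positions : ∀ (x d : Fin n) u′ p′ (e : Fin n) q′ {c} → c ∈ p′ → (x ∷ d ∷ c ∷ e ∷ []) ⊆ (x ∷ (d ∷ u′) ++ p′ ++ e ∷ q′)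
    four-positions x d u′ p′ e q′ c∈p′ =
      refl ∷ refl ∷ ++⁺ˡ u′ (++⁺ (from∈ c∈p′) (refl ∷ minimum q′))

    -- If x is
    -- neither below nor above all of v, the split of x ∷ v must be direct
    -- too, since a skew split would produce the pattern 3142.
    extend-direct : ∀ x u v → NonEmpty u → NonEmpty v → Below u v →
      Increasing (x ∷ u ++ v) → Avoids (x ∷ u ++ v) → Split (x ∷ v) → Split (x ∷ u ++ v)
    extend-direct x u v _ v-ne u<v (x<uv ∷ _) avoids split-xv with All.all? (λ q → val x <? val q) v
    ... | yes x<v = x ∷ u , v , refl , nonEmpty , v-ne , inj₁ (x<v ∷ u<v)
    ... | no ¬x<v with All.all? (λ q → val q <? val x) v
    ...   | yes v<x = x ∷ [] , u ++ v , refl , nonEmpty , ++-nonEmpty u v-ne ,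
                      inj₂ (Allₚ.++⁺ (All.map (λ p<v → below-x v-ne p<v v<x) u<v) (All.map (_∷ []) v<x))
      where
      below-x : ∀ {v p} → NonEmpty v → All (λ q → val p < val q) v → All (λ q → val q < val x) v →
        All (λ q → val p < val q) (x ∷ [])
      below-x nonEmpty (p<w ∷ _) (w<x ∷ _) = <-trans p<w w<x ∷ []
    ...   | no ¬v<x with some-above x v (Allₚ.++⁻ʳ u x<uv) ¬v<x | split-xv
    ...     | _ | [] , _ , _ , () , _
    ...     | _ | .x ∷ p′ , q , refl , _ , q-ne , inj₁ (x<q ∷ p′<q) =
      x ∷ u ++ p′ , q , cong (x ∷_) (++-assoc u p′ q) , nonEmpty , q-ne ,
      inj₁ (x<q ∷ Allₚ.++⁺ (All.map (Allₚ.++⁻ʳ p′) u<v) p′<q)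
    extend-direct x (d ∷ u′) .(p′ ++ e ∷ q′) _ _ u<v (x<uv ∷ _) avoids _
      | no _ | no _ | c , c∈v , x<c | .x ∷ p′ , e ∷ q′ , refl , _ , _ , inj₂ q<xp′ =
      ⊥-elim (proj₁ (avoids x d c e (four-positions x d u′ p′ e q′ c∈p′)) (d<e , e<x , x<c))
      where
      e<x : val e < val x
      e<x = All.head (All.head q<xp′)
      d<e : val d < val e
      d<e = All.lookup (All.head u<v) (∈-++⁺ʳ p′ (here refl))
      c∈p′ : c ∈ p′
      c∈p′ with ∈-++⁻ p′ c∈v
      ... | inj₁ c∈ = c∈
      ... | inj₂ c∈q = ⊥-elim (<-asym x<c (All.lookup (All.lookup q<xp′ c∈q) (here refl)))

    -- The mirror image: extending a skew-sum split, excluding 2413.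
    extend-skew : ∀ x u v → NonEmpty u → NonEmpty v → Below v u →
      Increasing (x ∷ u ++ v) → Avoids (x ∷ u ++ v) → Split (x ∷ v) → Split (x ∷ u ++ v)
    extend-skew x u v _ v-ne v<u (x<uv ∷ _) avoids split-xv with All.all? (λ q → val q <? val x) v
    ... | yes v<x = x ∷ u , v , refl , nonEmpty , v-ne , inj₂ (All.zipWith (λ (q<x , q<u) → q<x ∷ q<u) (v<x , v<u))
    ... | no ¬v<x with All.all? (λ q → val x <? val q) v
    ...   | yes x<v = x ∷ [] , u ++ v , refl , nonEmpty , ++-nonEmpty u v-ne ,
                      inj₁ (Allₚ.++⁺ (above-x v-ne x<v v<u) x<v ∷ [])
      where
      above-x : ∀ {v} → NonEmpty v → All (λ q → val x < val q) v → Below v u → All (λ q → val x < val q) u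
      above-x nonEmpty (x<w ∷ _) (w<u ∷ _) = All.map (<-trans x<w) w<u
    ...   | no ¬x<v with some-below x v (Allₚ.++⁻ʳ u x<uv) ¬x<v | split-xv
    ...     | _ | [] , _ , _ , () , _
    ...     | _ | .x ∷ p′ , q , refl , _ , q-ne , inj₂ q<xp′ =
      x ∷ u ++ p′ , q , cong (x ∷_) (++-assoc u p′ q) , nonEmpty , q-ne ,
      inj₂ (All.zipWith (λ (q<u , q<xp′) → All.head q<xp′ ∷ Allₚ.++⁺ q<u (All.tail q<xp′))
                        (Allₚ.++⁻ʳ p′ v<u , q<xp′))
    extend-skew x (d ∷ u′) .(p′ ++ e ∷ q′) _ _ v<u (x<uv ∷ _) avoids _
      | no _ | no _ | c , c∈v , c<x | .x ∷ p′ , e ∷ q′ , refl , _ , _ , inj₁ (x<q ∷ _) =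
      ⊥-elim (proj₂ (avoids x d c e (four-positions x d u′ p′ e q′ c∈p′)) (c<x , All.head x<q , e<d))
      where
      e<d : val e < val d
      e<d = All.head (All.lookup v<u (∈-++⁺ʳ p′ (here refl)))
      c∈p′ : c ∈ p′
      c∈p′ with ∈-++⁻ p′ c∈v
      ... | inj₁ c∈ = c∈
      ... | inj₂ c∈q = ⊥-elim (<-asym c<x (All.lookup x<q c∈q))

    split : ∀ k ps → length ps ≤ k → 2 ≤ length ps → Increasing ps → Avoids ps → Split ps
    split k [] _ () _ _
    split k (x ∷ []) _ (s≤s ()) _ _
    split zero (x ∷ y ∷ z ∷ rest) () _ _ _
    split k (x ∷ y ∷ []) _ _ ((x<y ∷ []) ∷ _) _ with val-trichotomy x<y
    ... | inj₁ lt = x ∷ [] , y ∷ [] , refl , nonEmpty , nonEmpty , inj₁ ((lt ∷ []) ∷ [])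
    ... | inj₂ gt = x ∷ [] , y ∷ [] , refl , nonEmpty , nonEmpty , inj₂ ((gt ∷ []) ∷ [])
    split (suc k) (x ∷ y ∷ z ∷ rest) (s≤s len≤) _ increasing@(_ ∷ increasing′) avoids
      with split k (y ∷ z ∷ rest) len≤ (s≤s (s≤s z≤n)) increasing′ (Avoids-⊆ (_ ∷ʳ ⊆-refl) avoids)
    ... | u , v , u++v≡ , u-ne , v-ne , direct-or-skew =
      subst (λ l → Split (x ∷ l)) u++v≡ (extend direct-or-skew)
      where
      increasing-uv : Increasing (x ∷ u ++ v)
      increasing-uv = subst (λ l → Increasing (x ∷ l)) (sym u++v≡) increasing
      avoids-uv : Avoids (x ∷ u ++ v)
      avoids-uv = subst (λ l → Avoids (x ∷ l)) (sym u++v≡) avoids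
      x∷v⊆ : (x ∷ v) ⊆ (x ∷ u ++ v)
      x∷v⊆ = refl ∷ ++⁺ˡ u ⊆-refl
      two-letters : ∀ {v} → NonEmpty v → 2 ≤ length (x ∷ v)
      two-letters nonEmpty = s≤s (s≤s z≤n)
      split-xv : Split (x ∷ v)
      split-xv = split k (x ∷ v) (≤-trans (++-length-right u v u-ne) (subst (λ l → length l ≤ k) (sym u++v≡) len≤))
                       (two-letters v-ne) (AllPairs-resp-⊆ x∷v⊆ increasing-uv) (Avoids-⊆ x∷v⊆ avoids-uv)
      extend : Below u v ⊎ Below v u → Split (x ∷ u ++ v)
      extend (inj₁ u<v) = extend-direct x u v u-ne v-ne u<v increasing-uv avoids-uv split-xv
      extend (inj₂ v<u) = extend-skew x u v u-ne v-ne v<u increasing-uv avoids-uv split-xv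

  All-zipCat : ∀ {A : Set} {Q₁ Q₂ R : List A → Set} Us Vs → All Q₁ Us → All Q₂ Vs →
    (∀ {a b} → Q₁ a → Q₂ b → R (a ++ b)) → (∀ {a} → Q₁ a → R a) → (∀ {b} → Q₂ b → R b) → All R (zipCat Us Vs)
  All-zipCat [] Vs _ q₂ _ _ right = All.map right q₂
  All-zipCat (a ∷ Us) [] q₁ _ _ left _ = All.map left q₁
  All-zipCat (a ∷ Us) (b ∷ Vs) (qa ∷ q₁) (qb ∷ q₂) both left right = both qa qb ∷ All-zipCat Us Vs q₁ q₂ both left right

  All-mergeOn : ∀ {A : Set} {Q : A → Set} (f : A → ℕ) X Y → All Q X → All Q Y → All Q (mergeOn f X Y)
  All-mergeOn f [] Y _ qY = qY
  All-mergeOn {Q = Q} f (x ∷ xs) Y (qx ∷ qxs) qY = against Y qY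
    where
    against : ∀ Y → All Q Y → All Q (mergeOn f (x ∷ xs) Y)
    against [] _ = qx ∷ qxs
    against (y ∷ ys) (qy ∷ qys) with f y ≤ᵇ f x
    ... | true  = qx ∷ All-mergeOn f xs (y ∷ ys) qxs (qy ∷ qys)
    ... | false = qy ∷ against ys qys

  AllPairs-mergeOn : ∀ {A : Set} {R : A → A → Set} (f : A → ℕ) → (∀ {a b} → R a b → R b a) →
    ∀ X Y → AllPairs R X → AllPairs R Y → All (λ x → All (R x) Y) X → AllPairs R (mergeOn f X Y)
  AllPairs-mergeOn f R-sym [] Y _ rY _ = rY
  AllPairs-mergeOn {R = R} f R-sym (x ∷ xs) Y (rx ∷ rxs) rY cross = against Y rY cross
    where
    against : ∀ Y → AllPairs R Y → All (λ x′ → All (R x′) Y) (x ∷ xs) → AllPairs R (mergeOn f (x ∷ xs) Y)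
    against [] _ _ = rx ∷ rxs
    against (y ∷ ys) (ry ∷ rys) (x-Y ∷ xs-Y) with f y ≤ᵇ f x
    ... | true  = All-mergeOn f xs (y ∷ ys) rx x-Y ∷ AllPairs-mergeOn f R-sym xs (y ∷ ys) rxs (ry ∷ rys) xs-Y
    ... | false = All-mergeOn f (x ∷ xs) ys (R-sym (All.head x-Y) ∷ All.map (R-sym ∘ All.head) xs-Y) ry
                  ∷ against ys rys (All.tail x-Y ∷ All.map All.tail xs-Y)

  module Families {n : ℕ} (σ : Fin n → Fin n) (σ-injective : IsPerm σ) where

    open SeparableWords σ σ-injective

    Disjoint : List (Fin n) → List (Fin n) → Set
    Disjoint u w = ∀ p → p ∈ u → p ∈ w → ⊥

    Disjoint-sym : ∀ {u w} → Disjoint u w → Disjoint w u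
    Disjoint-sym disj p p∈w p∈u = disj p p∈u p∈w

    Disjoint-++ˡ : ∀ {a b c} → Disjoint a c → Disjoint b c → Disjoint (a ++ b) c
    Disjoint-++ˡ {a} a-c b-c p p∈ab p∈c with ∈-++⁻ a p∈ab
    ... | inj₁ p∈a = a-c p p∈a p∈c
    ... | inj₂ p∈b = b-c p p∈b p∈c

    Disjoint-++ʳ : ∀ {a b c} → Disjoint a b → Disjoint a c → Disjoint a (b ++ c)
    Disjoint-++ʳ a-b a-c = Disjoint-sym (Disjoint-++ˡ (Disjoint-sym a-b) (Disjoint-sym a-c))

    Disjoint-halves : ∀ {u v a b} → Increasing (u ++ v) → a ⊆ u → b ⊆ v → Disjoint a b
    Disjoint-halves {u} increasing a⊆u b⊆v p p∈a p∈b =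
      <-irrefl refl (across u increasing (lookup a⊆u p∈a) (lookup b⊆v p∈b))
      where
      across : ∀ u {v p q} → Increasing (u ++ v) → p ∈ u → q ∈ v → p <F q
      across (x ∷ u) (x<uv ∷ _) (here refl) q∈v = All.lookup x<uv (∈-++⁺ʳ u q∈v)
      across (x ∷ u) (_ ∷ increasing) (there p∈u) q∈v = across u increasing p∈u q∈v

    ValueIncreasing : List (Fin n) → Set
    ValueIncreasing = AllPairs (λ p q → val p < val q)

    Family : List (Fin n) → Set
    Family ps = Σ (List (List (Fin n))) λ Us →
      All (_⊆ ps) Us × All ValueIncreasing Us × AllPairs Disjoint Us × sh Us ≡ sh (P (map val ps))

    threshold : ∀ u v → NonEmpty v → Below u v → Σ ℕ λ θ → All (_< θ) (map val u) × All (θ ≤_) (map val v)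
    threshold u (y ∷ v) _ u<v =
      min (val y) (map val v) ,
      Allₚ.map⁺ (All.map (λ p<yv → v<min⁺ (All.head p<yv) (Allₚ.map⁺ (All.tail p<yv))) u<v) ,
      min≤⊤ (val y) (map val v) ∷ min≤xs (val y) (map val v)

    -- Direct sum: glue the i-th subsequences of the two families.
    family-direct : ∀ u v → NonEmpty v → Below u v → Increasing (u ++ v) → Family u → Family v → Family (u ++ v)
    family-direct u v v-ne u<v increasing (Us , Us⊆ , Us-inc , Us-disj , sh-Us) (Vs , Vs⊆ , Vs-inc , Vs-disj , sh-Vs) =
      zipCat Us Vs ,
      All-zipCat Us Vs Us⊆ Vs⊆ ++⁺ (λ a⊆u → ++⁺ʳ v a⊆u) (++⁺ˡ u) ,
      All-zipCat Us Vs (All.zip (Us-inc , Us⊆)) (All.zip (Vs-inc , Vs⊆)) glue-increasing proj₁ proj₁ ,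
      disjoint-zipCat Us Vs Us⊆ Vs⊆ Us-disj Vs-disj ,
      lengths
      where
      glue-increasing : ∀ {a b} → ValueIncreasing a × a ⊆ u → ValueIncreasing b × b ⊆ v → ValueIncreasing (a ++ b)
      glue-increasing {a} {b} (a-inc , a⊆u) (b-inc , b⊆v) =
        AllPairsₚ.++⁺ a-inc b-inc (All.tabulate (λ p∈a → All.tabulate (λ q∈b → All.lookup (All.lookup u<v (lookup a⊆u p∈a)) (lookup b⊆v q∈b))))
      disjoint-zipCat : ∀ Us Vs → All (_⊆ u) Us → All (_⊆ v) Vs → AllPairs Disjoint Us → AllPairs Disjoint Vs →
        AllPairs Disjoint (zipCat Us Vs)
      disjoint-zipCat [] Vs _ _ _ Vs-disj = Vs-disj
      disjoint-zipCat (a ∷ Us) [] _ _ Us-disj _ = Us-disj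
      disjoint-zipCat (a ∷ Us) (b ∷ Vs) (a⊆u ∷ Us⊆) (b⊆v ∷ Vs⊆) (a-Us ∷ Us-disj) (b-Vs ∷ Vs-disj) =
        All-zipCat Us Vs (All.zip (Us⊆ , a-Us)) (All.zip (Vs⊆ , b-Vs))
          (λ (c⊆u , a-c) (d⊆v , b-d) → Disjoint-++ˡ (Disjoint-++ʳ a-c (Disjoint-halves increasing a⊆u d⊆v))
                                                    (Disjoint-++ʳ (Disjoint-sym (Disjoint-halves increasing c⊆u b⊆v)) b-d))
          (λ (c⊆u , a-c) → Disjoint-++ˡ a-c (Disjoint-sym (Disjoint-halves increasing c⊆u b⊆v)))
          (λ (d⊆v , b-d) → Disjoint-++ˡ (Disjoint-halves increasing a⊆u d⊆v) b-d)
        ∷ disjoint-zipCat Us Vs Us⊆ Vs⊆ Us-disj Vs-disj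
      lengths : sh (zipCat Us Vs) ≡ sh (P (map val (u ++ v)))
      lengths with threshold u v v-ne u<v
      ... | θ , u<θ , θ≤v = begin
        sh (zipCat Us Vs)                               ≡⟨ sh-zipCat Us Vs ⟩
        addShapes (sh Us) (sh Vs)                       ≡⟨ cong₂ addShapes sh-Us sh-Vs ⟩
        addShapes (sh (P (map val u))) (sh (P (map val v))) ≡⟨ sh-zipCat (P (map val u)) (P (map val v)) ⟨
        sh (zipCat (P (map val u)) (P (map val v)))     ≡⟨ cong sh (P-directSum θ (map val u) (map val v) u<θ θ≤v) ⟨
        sh (P (map val u ++ map val v))                 ≡⟨ cong (sh ∘ P) (map-++ val u v) ⟨
        sh (P (map val (u ++ v)))                       ∎
        where open ≡-Reasoning

    -- Skew sum: merge the two families, ordering subsequences by length.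
    family-skew : ∀ u v → NonEmpty u → Below v u → Increasing (u ++ v) → Family u → Family v → Family (u ++ v)
    family-skew u v u-ne v<u increasing (Us , Us⊆ , Us-inc , Us-disj , sh-Us) (Vs , Vs⊆ , Vs-inc , Vs-disj , sh-Vs) =
      mergeOn length Vs Us ,
      All-mergeOn length Vs Us (All.map (++⁺ˡ u) Vs⊆) (All.map (++⁺ʳ v) Us⊆) ,
      All-mergeOn length Vs Us Vs-inc Us-inc ,
      AllPairs-mergeOn length Disjoint-sym Vs Us Vs-disj Us-disj
        (All.map (λ b⊆v → All.map (λ a⊆u → Disjoint-sym (Disjoint-halves increasing a⊆u b⊆v)) Us⊆) Vs⊆) ,
      lengths
      where
      lengths : sh (mergeOn length Vs Us) ≡ sh (P (map val (u ++ v)))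
      lengths with threshold v u u-ne v<u
      ... | θ , v<θ , θ≤u = begin
        sh (mergeOn length Vs Us)                        ≡⟨ map-mergeOn length Vs Us ⟩
        mergeShapes (sh Vs) (sh Us)                      ≡⟨ cong₂ mergeShapes sh-Vs sh-Us ⟩
        mergeShapes (sh (P (map val v))) (sh (P (map val u))) ≡⟨ sh-stack (P (map val v)) (P (map val u)) (P-IsTableau (map val v)) (P-IsTableau (map val u)) ⟨
        sh (stack (P (map val v)) (P (map val u)))       ≡⟨ cong sh (P-skewSum θ (map val u) (map val v) θ≤u v<θ) ⟨
        sh (P (map val u ++ map val v))                  ≡⟨ cong (sh ∘ P) (map-++ val u v) ⟨
        sh (P (map val (u ++ v)))                        ∎
        where open ≡-Reasoning

    family : ∀ k ps → length ps ≤ k → Increasing ps → Avoids ps → Family ps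
    family k [] _ _ _ = [] , [] , [] , [] , refl
    family k (p ∷ []) _ _ _ = (p ∷ []) ∷ [] , ⊆-refl ∷ [] , ([] ∷ []) ∷ [] , [] ∷ [] , refl
    family zero (p ∷ q ∷ ps) () _ _
    family (suc k) (p ∷ q ∷ ps) len≤ increasing avoids
      with split (suc k) (p ∷ q ∷ ps) len≤ (s≤s (s≤s z≤n)) increasing avoids
    ... | u , v , u++v≡ , u-ne , v-ne , direct-or-skew = subst Family u++v≡ (combine direct-or-skew)
      where
      increasing-uv : Increasing (u ++ v)
      increasing-uv = subst Increasing (sym u++v≡) increasing
      avoids-uv : Avoids (u ++ v)
      avoids-uv = subst Avoids (sym u++v≡) avoids
      len-uv≤ : length (u ++ v) ≤ suc k
      len-uv≤ = subst (λ l → length l ≤ suc k) (sym u++v≡) len≤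
      u⊆ : u ⊆ u ++ v
      u⊆ = ++⁺ʳ v ⊆-refl
      v⊆ : v ⊆ u ++ v
      v⊆ = ++⁺ˡ u ⊆-refl
      family-u : Family u
      family-u = family k u (≤-pred (≤-trans (++-length-left u v v-ne) len-uv≤))
                        (AllPairs-resp-⊆ u⊆ increasing-uv) (Avoids-⊆ u⊆ avoids-uv)
      family-v : Family v
      family-v = family k v (≤-pred (≤-trans (++-length-right u v u-ne) len-uv≤))
                        (AllPairs-resp-⊆ v⊆ increasing-uv) (Avoids-⊆ v⊆ avoids-uv)
      combine : Below u v ⊎ Below v u → Family (u ++ v)
      combine (inj₁ u<v) = family-direct u v v-ne u<v increasing-uv family-u family-v
      combine (inj₂ v<u) = family-skew u v u-ne v<u increasing-uv family-u family-v

  containsZero : ∀ {n} → List (Fin (suc n)) → Bool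
  containsZero [] = false
  containsZero (fzero ∷ _) = true
  containsZero (fsuc _ ∷ X) = containsZero X

  predecessors : ∀ {n} → List (Fin (suc n)) → List (Fin n)
  predecessors [] = []
  predecessors (fzero ∷ X) = predecessors X
  predecessors (fsuc i ∷ X) = i ∷ predecessors X

  toSubset : ∀ {n} → List (Fin n) → Subset n
  toSubset {zero} X = []
  toSubset {suc n} X = containsZero X ∷ toSubset (predecessors X)

  containsZero-sound : ∀ {n} (X : List (Fin (suc n))) → containsZero X ≡ true → fzero ∈ X
  containsZero-sound (fzero ∷ X) _ = here refl
  containsZero-sound (fsuc _ ∷ X) e = there (containsZero-sound X e)

  predecessors-sound : ∀ {n} {i : Fin n} (X : List (Fin (suc n))) → i ∈ predecessors X → fsuc i ∈ X
  predecessors-sound (fzero ∷ X) i∈ = there (predecessors-sound X i∈)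
  predecessors-sound (fsuc _ ∷ X) (here refl) = here refl
  predecessors-sound (fsuc _ ∷ X) (there i∈) = there (predecessors-sound X i∈)

  toSubset-sound : ∀ {n} {p : Fin n} X → p ∈ₛ toSubset X → p ∈ X
  toSubset-sound {suc n} {fzero} X p∈ = containsZero-sound X (head-inside p∈)
    where
    head-inside : ∀ {b : Bool} {s : Subset n} → fzero ∈ₛ (b ∷ s) → b ≡ true
    head-inside here = refl
  toSubset-sound {suc n} {fsuc p} X (there p∈) = predecessors-sound X (toSubset-sound (predecessors X) p∈)

  ∣toSubset-[]∣ : ∀ n → ∣ toSubset {n} [] ∣ ≡ 0
  ∣toSubset-[]∣ zero = refl
  ∣toSubset-[]∣ (suc n) = ∣toSubset-[]∣ n

  module _ {n : ℕ} where

    containsZero-positive : ∀ (X : List (Fin (suc n))) → All (fzero {n} <F_) X → containsZero X ≡ false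
    containsZero-positive [] _ = refl
    containsZero-positive (fzero ∷ X) (0<0 ∷ _) = ⊥-elim (<-irrefl refl 0<0)
    containsZero-positive (fsuc _ ∷ X) (_ ∷ 0<X) = containsZero-positive X 0<X

    length-predecessors : ∀ (X : List (Fin (suc n))) → All (fzero {n} <F_) X → length (predecessors X) ≡ length X
    length-predecessors [] _ = refl
    length-predecessors (fzero ∷ X) (0<0 ∷ _) = ⊥-elim (<-irrefl refl 0<0)
    length-predecessors (fsuc _ ∷ X) (_ ∷ 0<X) = cong suc (length-predecessors X 0<X)

    predecessors-above : ∀ {i : Fin n} (X : List (Fin (suc n))) → All (fsuc i <F_) X → All (i <F_) (predecessors X)
    predecessors-above [] _ = []
    predecessors-above (fzero ∷ X) (() ∷ _)
    predecessors-above (fsuc _ ∷ X) (s≤s i<x ∷ i<X) = i<x ∷ predecessors-above X i<X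

    predecessors-increasing : ∀ (X : List (Fin (suc n))) → AllPairs _<F_ X → All (fzero {n} <F_) X →
      AllPairs _<F_ (predecessors X)
    predecessors-increasing [] _ _ = []
    predecessors-increasing (fzero ∷ X) _ (0<0 ∷ _) = ⊥-elim (<-irrefl refl 0<0)
    predecessors-increasing (fsuc _ ∷ X) (x<X ∷ increasing) (_ ∷ 0<X) =
      predecessors-above X x<X ∷ predecessors-increasing X increasing 0<X

  ∣toSubset∣ : ∀ {n} (X : List (Fin n)) → AllPairs _<F_ X → ∣ toSubset X ∣ ≡ length X
  ∣toSubset∣ {zero} [] _ = refl
  ∣toSubset∣ {zero} (() ∷ _) _
  ∣toSubset∣ {suc n} [] _ = ∣toSubset-[]∣ n
  ∣toSubset∣ {suc n} (fzero ∷ X) (0<X ∷ increasing) =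
    cong suc (trans (∣toSubset∣ (predecessors X) (predecessors-increasing X increasing 0<X)) (length-predecessors X 0<X))
  ∣toSubset∣ {suc n} (fsuc i ∷ X) (i<X ∷ increasing)
    rewrite containsZero-positive X (All.map (<-trans (s≤s z≤n)) i<X) =
    trans (∣toSubset∣ (i ∷ predecessors X) (predecessors-above X i<X ∷ predecessors-increasing X increasing 0<X))
          (cong suc (length-predecessors X 0<X))
    where
    0<X : All (fzero {n} <F_) X
    0<X = All.map (<-trans (s≤s z≤n)) i<X

  -- A map on Fin (suc m) increasing at each step is
  -- increasing; so τ contains π once positions f increase step by step and
  -- the values of τ ∘ f increase step by step along g = π⁻¹.
  increasing-steps : ∀ {m} (h : Fin (suc m) → ℕ) → (∀ k → h (inject₁ k) < h (fsuc k)) →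
    ∀ a b → a <F b → h a < h b
  increasing-steps h step fzero fzero ()
  increasing-steps h step (fsuc a) fzero ()
  increasing-steps {suc m} h step fzero (fsuc fzero) _ = step fzero
  increasing-steps {suc m} h step fzero (fsuc (fsuc b)) _ =
    <-trans (step fzero) (increasing-steps (h ∘ fsuc) (step ∘ fsuc) fzero (fsuc b) (s≤s z≤n))
  increasing-steps {suc m} h step (fsuc a) (fsuc b) (s≤s a<b) = increasing-steps (h ∘ fsuc) (step ∘ fsuc) a b a<b

  contains-from-steps : ∀ {n m} (τ : Fin n → Fin n) (π g : Fin (suc m) → Fin (suc m)) → (∀ a → g (π a) ≡ a) →
    (f : Fin (suc m) → Fin n) → (∀ k → f (inject₁ k) <F f (fsuc k)) →
    (∀ k → τ (f (g (inject₁ k))) <F τ (f (g (fsuc k)))) → Contains τ π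
  contains-from-steps τ π g g∘π f f-steps τf-steps =
    f , increasing-steps (toℕ ∘ f) f-steps , λ a b → mk⇔ (forward a b) (backward a b)
    where
    forward : ∀ a b → π a <F π b → τ (f a) <F τ (f b)
    forward a b πa<πb = subst₂ (λ x y → τ (f x) <F τ (f y)) (g∘π a) (g∘π b)
      (increasing-steps (λ k → toℕ (τ (f (g k)))) τf-steps (π a) (π b) πa<πb)
    backward : ∀ a b → τ (f a) <F τ (f b) → π a <F π b
    backward a b τfa<τfb with <-cmp (toℕ (π a)) (toℕ (π b))
    ... | tri< πa<πb _ _ = πa<πb
    ... | tri≈ _ πa≡πb _ = ⊥-elim (<-irrefl (cong (λ x → toℕ (τ (f x))) a≡b) τfa<τfb)
      where
      a≡b : a ≡ b
      a≡b = trans (sym (g∘π a)) (trans (cong g (toℕ-injective πa≡πb)) (g∘π b))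
    ... | tri> _ _ πb<πa = ⊥-elim (<-asym τfa<τfb (forward b a πb<πa))

  -- The k-th member of a family (counting from 0), or [] past its end.
  member : ∀ {A : Set} → List (List A) → ℕ → List A
  member [] k = []
  member (U ∷ Us) zero = U
  member (U ∷ Us) (suc k) = member Us k

  length-member : ∀ {A : Set} (Us : List (List A)) k → length (member Us k) ≡ part (sh Us) k
  length-member [] k = refl
  length-member (U ∷ Us) zero = refl
  length-member (U ∷ Us) (suc k) = length-member Us k

  member-All : ∀ {A : Set} {Q : List A → Set} (Us : List (List A)) k → All Q Us → Q [] → Q (member Us k)
  member-All [] k _ q[] = q[]
  member-All (U ∷ Us) zero (qU ∷ _) _ = qU
  member-All (U ∷ Us) (suc k) (_ ∷ qUs) q[] = member-All Us k qUs q[]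

  member-AllPairs : ∀ {A : Set} {R : List A → List A → Set} → (∀ {a b} → R a b → R b a) → (∀ a → R a []) →
    ∀ (Us : List (List A)) k l → AllPairs R Us → k ≢ l → R (member Us k) (member Us l)
  member-AllPairs R-sym R-[] [] k l _ _ = R-[] []
  member-AllPairs R-sym R-[] (U ∷ Us) zero zero _ k≢l = ⊥-elim (k≢l refl)
  member-AllPairs R-sym R-[] (U ∷ Us) zero (suc l) (U-Us ∷ _) _ = member-All Us l U-Us (R-[] U)
  member-AllPairs R-sym R-[] (U ∷ Us) (suc k) zero (U-Us ∷ _) _ = R-sym (member-All Us k U-Us (R-[] U))
  member-AllPairs R-sym R-[] (U ∷ Us) (suc k) (suc l) (_ ∷ rel) k≢l =
    member-AllPairs R-sym R-[] Us k l rel (k≢l ∘ cong suc)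

  AllPairs-∈ : ∀ {A : Set} {R : A → A → Set} {X p q} → AllPairs R X → p ∈ X → q ∈ X → p ≡ q ⊎ R p q ⊎ R q p
  AllPairs-∈ (_ ∷ _) (here refl) (here refl) = inj₁ refl
  AllPairs-∈ (p-X ∷ _) (here refl) (there q∈) = inj₂ (inj₁ (All.lookup p-X q∈))
  AllPairs-∈ (q-X ∷ _) (there p∈) (here refl) = inj₂ (inj₂ (All.lookup q-X p∈))
  AllPairs-∈ (_ ∷ rel) (there p∈) (there q∈) = AllPairs-∈ rel p∈ q∈

  module Main {n : ℕ} (σ : Fin n → Fin n) (σ-injective : IsPerm σ) (separable : Separable σ) where

    open SeparableWords σ σ-injective
    open Families σ σ-injective

    quadruple : Fin n → Fin n → Fin n → Fin n → Fin 4 → Fin n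
    quadruple a b c d fzero = a
    quadruple a b c d (fsuc fzero) = b
    quadruple a b c d (fsuc (fsuc fzero)) = c
    quadruple a b c d (fsuc (fsuc (fsuc fzero))) = d

    quadruple-steps : ∀ {a b c d} → a <F b → b <F c → c <F d →
      ∀ k → quadruple a b c d (inject₁ k) <F quadruple a b c d (fsuc k)
    quadruple-steps a<b _ _ fzero = a<b
    quadruple-steps _ b<c _ (fsuc fzero) = b<c
    quadruple-steps _ _ c<d (fsuc (fsuc fzero)) = c<d

    p2413∘p3142 : ∀ a → p2413 (p3142 a) ≡ a
    p2413∘p3142 fzero = refl
    p2413∘p3142 (fsuc fzero) = refl
    p2413∘p3142 (fsuc (fsuc fzero)) = refl
    p2413∘p3142 (fsuc (fsuc (fsuc fzero))) = refl

    p3142∘p2413 : ∀ a → p3142 (p2413 a) ≡ a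
    p3142∘p2413 fzero = refl
    p3142∘p2413 (fsuc fzero) = refl
    p3142∘p2413 (fsuc (fsuc fzero)) = refl
    p3142∘p2413 (fsuc (fsuc (fsuc fzero))) = refl

    allFin-increasing : Increasing (allFin n)
    allFin-increasing = AllPairsₚ.tabulate⁺-< (λ i<j → i<j)

    allFin-avoids : Avoids (allFin n)
    allFin-avoids a b c d τ with AllPairs-resp-⊆ τ allFin-increasing
    ... | (a<b ∷ _ ∷ _ ∷ []) ∷ (b<c ∷ _ ∷ []) ∷ (c<d ∷ []) ∷ [] ∷ [] =
      (λ (b≺d , d≺a , a≺c) → proj₁ separable
          (contains-from-steps σ p3142 p2413 p2413∘p3142 (quadruple a b c d) (quadruple-steps a<b b<c c<d)
            λ { fzero → b≺d ; (fsuc fzero) → d≺a ; (fsuc (fsuc fzero)) → a≺c })) ,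
      (λ (c≺a , a≺d , d≺b) → proj₂ separable
          (contains-from-steps σ p2413 p3142 p3142∘p2413 (quadruple a b c d) (quadruple-steps a<b b<c c<d)
            λ { fzero → c≺a ; (fsuc fzero) → a≺d ; (fsuc (fsuc fzero)) → d≺b }))

    family-σ : Family (allFin n)
    family-σ = family n (allFin n) (≤-reflexive (length-tabulate (λ i → i))) allFin-increasing allFin-avoids

    members : ℕ → List (Fin n)
    members = member (proj₁ family-σ)

    members-⊆ : ∀ k → members k ⊆ allFin n
    members-⊆ k = member-All (proj₁ family-σ) k (proj₁ (proj₂ family-σ)) (minimum _)

    subsets-disjoint : ∀ k l → k ≢ l → ∀ p → p ∈ₛ toSubset (members k) → ¬ (p ∈ₛ toSubset (members l))
    subsets-disjoint k l k≢l p p∈k p∈l =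
      member-AllPairs Disjoint-sym (λ _ _ _ ()) (proj₁ family-σ) k l (proj₁ (proj₂ (proj₂ (proj₂ family-σ)))) k≢l
        p (toSubset-sound (members k) p∈k) (toSubset-sound (members l) p∈l)

    subsets-increasing : ∀ k p q → p ∈ₛ toSubset (members k) → q ∈ₛ toSubset (members k) → p <F q → σ p <F σ q
    subsets-increasing k p q p∈ q∈ p<q
      with AllPairs-∈ (AllPairs.zip (AllPairs-resp-⊆ (members-⊆ k) allFin-increasing , value-increasing))
                      (toSubset-sound (members k) p∈) (toSubset-sound (members k) q∈)
      where
      value-increasing : ValueIncreasing (members k)
      value-increasing = member-All (proj₁ family-σ) k (proj₁ (proj₂ (proj₂ family-σ))) []
    ... | inj₁ refl = ⊥-elim (<-irrefl refl p<q)
    ... | inj₂ (inj₁ (_ , σp<σq)) = σp<σq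
    ... | inj₂ (inj₂ (q<p , _)) = ⊥-elim (<-asym p<q q<p)

    subsets-size : ∀ k → ∣ toSubset (members k) ∣ ≡ part (shape σ) k
    subsets-size k = begin
      ∣ toSubset (members k) ∣          ≡⟨ ∣toSubset∣ (members k) (AllPairs-resp-⊆ (members-⊆ k) allFin-increasing) ⟩
      length (members k)                ≡⟨ length-member (proj₁ family-σ) k ⟩
      part (sh (proj₁ family-σ)) k      ≡⟨ cong (λ s → part s k) (proj₂ (proj₂ (proj₂ (proj₂ family-σ)))) ⟩
      part (shape σ) k                  ∎
      where open ≡-Reasoning


open import Defs
open import Data.Nat using (ℕ; _≤_)
open import Data.Fin using (Fin; toℕ; _<_)
open import Data.Fin.Properties using (toℕ-injective)
open import Data.Fin.Subset using (Subset; _∈_; _∉_; ∣_∣)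
open import Data.Product using (Σ; _×_; _,_)
open import Function using (_∘_)
open import Relation.Binary.PropositionalEquality using (_≡_; _≢_)
open SeparableRSK using (toSubset; module Main)

proposition2p7 : (n : ℕ) (σ : Fin n → Fin n) → IsPerm σ → Separable σ →
    (d : ℕ) → 1 ≤ d →
    Σ (Fin d → Subset n) λ u →
      (∀ i j → i ≢ j → ∀ p → p ∈ u i → p ∉ u j) ×
      (∀ i p q → p ∈ u i → q ∈ u i → p < q → σ p < σ q) ×
      (∀ i → ∣ u i ∣ ≡ part (shape σ) (toℕ i))
proposition2p7 n σ σ-injective separable d _ =
  (λ i → toSubset (members (toℕ i))) ,
  (λ i j i≢j → subsets-disjoint (toℕ i) (toℕ j) (i≢j ∘ toℕ-injective)) ,
  (λ i → subsets-increasing (toℕ i)) ,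
  (λ i → subsets-size (toℕ i))
  where open Main σ σ-injective separable
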